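{- For any graph $H\in \mathscr{F}$ with $\delta'(H)=2$, there exists a constant $c_H$ such that $\mathrm{rwsat}(n, H)\leq \frac{3}{2}n+c_H$ for all $n$.
   Context: All graphs are finite and simple. $\mathscr{F}$ is the family of graphs $H$ containing an edge $uv$ with $d_H(u)=d_H(v)=2$ such that $uv$ is the middle edge of an induced subgraph of $H$ isomorphic to the path $P_4$ on four vertices. $\delta'(H)=\min\{d_H(v)\colon v\in V(H),\ d_H(v)\neq 0\}$. An edge-coloring of $G$ is a map $c\colon E(G)\to\mathbb{N}$; a subgraph is rainbow if its edges have pairwise distinct colors. An edge-colored graph $G$ is weakly $H$-rainbow saturated if there exists an ordering $e_1,\dots,e_m$ of the non-edges of $G$ such that for every list $c_1,\dots,c_m$ of pairwise distinct colors from $\mathbb{N}$ (possibly coinciding with colors used on $G$), for every $i\in[m]$ the edge-colored graph obtained from $G$ by adding $e_1,\dots,e_i$ with $e_k$ colored $c_k$ contains a rainbow copy of $H$ containing $e_i$ ($G$ need not be rainbow-$H$-free). $\mathrm{rwsat}(n,H)$ is the minimum number of edges of such a graph on $n$ vertices (defined as $\binom n2$ if none exists). -}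

module Defs where

open import Data.Nat using (ℕ; _<_; _≤_; _<ᵇ_)
open import Data.Bool using (Bool; true; false; _∧_)
open import Data.Fin using (Fin; toℕ)
open import Data.Maybe using (Maybe; just; nothing; is-just)
open import Data.List using (List; length; filterᵇ; cartesianProduct; allFin)
open import Data.Product using (Σ; Σ-syntax; ∃; ∃-syntax; _×_; _,_; proj₁; proj₂)
open import Data.Sum using (_⊎_)
open import Relation.Nullary using (¬_)
open import Relation.Binary.PropositionalEquality using (_≡_; _≢_)
open import Function.Definitions using (Injective)

record Graph (k : ℕ) : Set where
  field
    adj    : Fin k → Fin k → Bool
    sym    : ∀ x y → adj x y ≡ adj y x
    irrefl : ∀ x → adj x x ≡ false
open Graph public

deg : ∀ {k} → Graph k → Fin k → ℕ
deg {k} H v = length (filterᵇ (λ u → adj H v u) (allFin k))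

δ'≡2 : ∀ {k} → Graph k → Set
δ'≡2 H = (∃[ v ] deg H v ≡ 2) × (∀ v → deg H v ≢ 0 → 2 ≤ deg H v)

-- H ∈ 𝓕 : an edge uv with d(u) = d(v) = 2 which is the middle edge of an
-- induced P4  a - u - v - b.
InF : ∀ {k} → Graph k → Set
InF H = Σ[ u ∈ _ ] Σ[ v ∈ _ ] Σ[ a ∈ _ ] Σ[ b ∈ _ ]
  ( deg H u ≡ 2 × deg H v ≡ 2
  × a ≢ u × a ≢ v × a ≢ b × u ≢ v × u ≢ b × v ≢ b
  × adj H a u ≡ true × adj H u v ≡ true × adj H v b ≡ true
  × adj H a v ≡ false × adj H a b ≡ false × adj H u b ≡ false )

-- An edge-coloured finite simple graph on Fin n:
-- col x y = just c  iff  xy is an edge, with colour c; nothing iff non-edge.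
record ColGraph (n : ℕ) : Set where
  field
    col    : Fin n → Fin n → Maybe ℕ
    csym   : ∀ x y → col x y ≡ col y x
    cirr   : ∀ x → col x x ≡ nothing
open ColGraph public

eCount : ∀ {n} → ColGraph n → ℕ
eCount {n} G = length (filterᵇ
  (λ p → (toℕ (proj₁ p) <ᵇ toℕ (proj₂ p)) ∧ is-just (col G (proj₁ p) (proj₂ p)))
  (cartesianProduct (allFin n) (allFin n)))

-- In the graph obtained from G by adding e_1,…,e_i (e_k coloured cs k),
-- the pair xy is an edge of colour c.
HasCol : ∀ {n m} → ColGraph n → (Fin m → Fin n × Fin n) → (Fin m → ℕ) → Fin m →
         Fin n → Fin n → ℕ → Set
HasCol G e cs i x y c =
  col G x y ≡ just c
  ⊎ (∃[ k ] (toℕ k ≤ toℕ i × (e k ≡ (x , y) ⊎ e k ≡ (y , x)) × cs k ≡ c))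

RainbowCopyWith : ∀ {k n m} → Graph k → ColGraph n → (Fin m → Fin n × Fin n) →
                  (Fin m → ℕ) → Fin m → Set
RainbowCopyWith {k} {n} H G e cs i =
  Σ[ φ ∈ (Fin k → Fin n) ] Σ[ χ ∈ (Fin k → Fin k → ℕ) ]
    ( Injective _≡_ _≡_ φ
    × (∀ u v → adj H u v ≡ true → HasCol G e cs i (φ u) (φ v) (χ u v))
    × (∀ u v u' v' → adj H u v ≡ true → adj H u' v' ≡ true → χ u v ≡ χ u' v' →
          (u ≡ u' × v ≡ v') ⊎ (u ≡ v' × v ≡ u'))
    × (∃[ u ] ∃[ v ] (adj H u v ≡ true × (φ u , φ v) ≡ e i)) )

WeaklyRainbowSat : ∀ {k n} → Graph k → ColGraph n → Set
WeaklyRainbowSat {k} {n} H G =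
  Σ[ m ∈ ℕ ] Σ[ e ∈ (Fin m → Fin n × Fin n) ]
    ( (∀ j → toℕ (proj₁ (e j)) < toℕ (proj₂ (e j)) × col G (proj₁ (e j)) (proj₂ (e j)) ≡ nothing)
    × Injective _≡_ _≡_ e
    × (∀ x y → toℕ x < toℕ y → col G x y ≡ nothing → ∃[ j ] e j ≡ (x , y))
    × (∀ (cs : Fin m → ℕ) → Injective _≡_ _≡_ cs → ∀ i → RainbowCopyWith H G e cs i) )

{-# OPTIONS --safe #-}
-- Take N outer vertices and a clique K on s = 8 + 11k further vertices, among them two hubs and a
-- pool of six.  Outer vertices are paired by a matching and each is joined to one hub, so the graph
-- has about 3N/2 + s² edges; every edge is coloured by an injective code of its endpoints.  The
-- outer–pool non-edges are added first.  Each added edge then lies on a rainbow path p x y q of the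
-- current graph with p, q in K.  Since u and v have degree 2 in H, mapping a–u–v–b onto p–x–y–q and
-- the rest of H into the vertices of K in one residue class mod 11 gives a copy of H containing the
-- new edge; a suitable residue class keeps the rest of H off the path and its colours off the path
-- colours, so the copy is rainbow.  Small n are handled by the complete graph.
module Submission where

open import Defs hiding (sym)
open import Data.Nat using (ℕ; _≤_; _+_; _*_)
open import Data.Product using (Σ-syntax; ∃-syntax; _×_)

open import Data.Bool using (Bool; true; false; T; if_then_else_; not; _∧_)
open import Data.Bool.Properties using (T-∧; not-injective; ¬-not) renaming (_≟_ to _≟ᵇ_)
open import Data.Empty using (⊥; ⊥-elim)
open import Data.Fin as Fin using (Fin; toℕ; fromℕ<)
open import Data.Fin.Properties using (toℕ-injective; toℕ-fromℕ<; toℕ<n)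
open import Data.List using (List; []; _∷_; _++_; length; map; filter; filterᵇ; allFin; tabulate; cartesianProduct; lookup)
open import Data.List.Membership.Propositional using (_∈_; _∉_)
open import Data.List.Membership.Propositional.Properties using (∈-filter⁺; ∈-filter⁻; ∈-allFin; ∈-map⁺; ∈-++⁺ˡ; ∈-++⁺ʳ; ∈-++⁻; ∈-lookup; ∈-cartesianProduct⁺)
open import Data.List.Properties using (filter-notAll; filter-++; length-++; length-filter; length-map; length-tabulate)
open import Data.List.Relation.Binary.Subset.Propositional using (_⊆_)
import Data.List.Relation.Unary.All as All
open import Data.List.Relation.Unary.AllPairs using (_∷_)
open import Data.List.Relation.Unary.Any using (here; there; index)
import Data.List.Relation.Unary.Any as Any
open import Data.List.Relation.Unary.Any.Properties using (lookup-index)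
open import Data.List.Relation.Unary.Unique.Propositional using (Unique)
import Data.List.Relation.Unary.Unique.Propositional.Properties as Unique
open import Data.Maybe using (Maybe; just; nothing; is-just)
open import Data.Maybe.Properties using (≡-dec)
open import Data.Nat using (zero; suc; _∸_; _⊓_; _⊔_; _<_; z≤n; s≤s; NonZero; _%_; _/_; _≡ᵇ_; _<ᵇ_; _<?_; _≤?_; >-nonZero)
open import Data.Nat.DivMod using ([m+kn]%n≡m%n; m<n⇒m%n≡m; +-distrib-/; m<n⇒m/n≡0; m*n/n≡m; m*n%n≡0)
open import Data.Nat.ListAction using (sum)
open import Data.Nat.Properties
open import Algebra.Properties.CommutativeSemigroup +-commutativeSemigroup using () renaming (interchange to +-interchange)
open import Data.List.Membership.DecPropositional _≟_ using (_∈?_)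
open import Data.Product using (_,_; proj₁; proj₂; uncurry)
import Data.Product as Product
open import Data.Sum using (_⊎_; inj₁; inj₂; [_,_]′)
import Data.Sum as Sum
open import Data.Unit using (tt)
open import Function using (_∘_; id)
open import Function.Bundles using (Equivalence)
open import Function.Definitions using (Injective)
open import Relation.Binary.Definitions using (tri<; tri≈; tri>)
open import Relation.Binary.PropositionalEquality
open import Relation.Nullary using (¬_; yes; no; ¬?; Dec)
open import Relation.Nullary.Decidable using (_×-dec_; _⊎-dec_; T?; toSum)
open import Relation.Unary using (Decidable)
open import Relation.Unary.Properties using (_∩?_; ∁?)

∈⇒1≤length : ∀ {A : Set} {l : List A} {x : A} → x ∈ l → 1 ≤ length l
∈⇒1≤length (here _)  = s≤s z≤n
∈⇒1≤length (there _) = s≤s z≤n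

distinct∈⇒2≤length : ∀ {A : Set} {l : List A} {x y : A} → x ∈ l → y ∈ l → x ≢ y → 2 ≤ length l
distinct∈⇒2≤length (here refl) (here refl) x≢y = ⊥-elim (x≢y refl)
distinct∈⇒2≤length (here _)    (there y∈) _   = s≤s (∈⇒1≤length y∈)
distinct∈⇒2≤length (there x∈)  (here _)   _   = s≤s (∈⇒1≤length x∈)
distinct∈⇒2≤length (there x∈)  (there y∈) x≢y = m≤n⇒m≤1+n (distinct∈⇒2≤length x∈ y∈ x≢y)

distinct∈⇒3≤length : ∀ {A : Set} {l : List A} {x y z : A} → x ∈ l → y ∈ l → z ∈ l →
                     x ≢ y → x ≢ z → y ≢ z → 3 ≤ length l
distinct∈⇒3≤length (here refl) (here refl) _           x≢y _   _   = ⊥-elim (x≢y refl)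
distinct∈⇒3≤length (here refl) (there _)   (here refl) _   x≢z _   = ⊥-elim (x≢z refl)
distinct∈⇒3≤length (there _)   (here refl) (here refl) _   _   y≢z = ⊥-elim (y≢z refl)
distinct∈⇒3≤length (here _)    (there y∈)  (there z∈)  _   _   y≢z = s≤s (distinct∈⇒2≤length y∈ z∈ y≢z)
distinct∈⇒3≤length (there x∈)  (here _)    (there z∈)  _   x≢z _   = s≤s (distinct∈⇒2≤length x∈ z∈ x≢z)
distinct∈⇒3≤length (there x∈)  (there y∈)  (here _)    x≢y _   _   = s≤s (distinct∈⇒2≤length x∈ y∈ x≢y)
distinct∈⇒3≤length (there x∈)  (there y∈)  (there z∈)  x≢y x≢z y≢z =
  m≤n⇒m≤1+n (distinct∈⇒3≤length x∈ y∈ z∈ x≢y x≢z y≢z)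

deg≡2⇒neighbour : ∀ {k} (H : Graph k) {w x y z : Fin k} → deg H w ≡ 2 →
                  adj H w x ≡ true → adj H w y ≡ true → x ≢ y → adj H w z ≡ true → z ≡ x ⊎ z ≡ y
deg≡2⇒neighbour {k} H {w} {x} {y} {z} deg≡2 wx wy x≢y wz with z Fin.≟ x | z Fin.≟ y
... | yes z≡x | _       = inj₁ z≡x
... | no _    | yes z≡y = inj₂ z≡y
... | no z≢x  | no z≢y  = ⊥-elim (<⇒≱ (≤-reflexive (cong suc deg≡2))
        (distinct∈⇒3≤length (neighbour wx) (neighbour wy) (neighbour wz) x≢y (≢-sym z≢x) (≢-sym z≢y)))
  where
  neighbour : ∀ {r} → adj H w r ≡ true → r ∈ filterᵇ (adj H w) (allFin k)
  neighbour {r} wr = ∈-filter⁺ (T? ∘ adj H w) (∈-allFin r) (subst T (sym wr) tt)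

opaque
  fresh≤ : ∀ m (L : List ℕ) → length L ≤ m → ∃[ t ] t ≤ m × t ∉ L
  fresh≤ zero    []      _   = 0 , z≤n , λ ()
  fresh≤ (suc m) L       len with suc m ∈? L
  ... | no  m∉L = suc m , ≤-refl , m∉L
  ... | yes m∈L with fresh≤ m (filter (λ f → ¬? (f ≟ suc m)) L) shorter
    where
    shorter : length (filter (λ f → ¬? (f ≟ suc m)) L) ≤ m
    shorter = ≤-pred (≤-trans (filter-notAll (λ f → ¬? (f ≟ suc m)) L (Any.map (λ eq ne → ne (sym eq)) m∈L)) len)
  ...   | t , t≤m , t∉ = t , m≤n⇒m≤1+n t≤m ,
            λ t∈L → t∉ (∈-filter⁺ (λ f → ¬? (f ≟ suc m)) t∈L λ t≡ → <⇒≱ (s≤s t≤m) (≤-reflexive (sym t≡)))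

pairCode : ℕ → ℕ → ℕ → ℕ
pairCode n z z' = z ⊓ z' + n * (z ⊔ z')

digits : ∀ n .{{_ : NonZero n}} → ℕ → List ℕ
digits n c = c % n ∷ c / n ∷ []

pairCode-comm : ∀ n z z' → pairCode n z z' ≡ pairCode n z' z
pairCode-comm n z z' = cong₂ (λ lo hi → lo + n * hi) (⊓-comm z z') (⊔-comm z z')

⊓-⊔-unordered : ∀ a b c d → a ⊓ b ≡ c ⊓ d → a ⊔ b ≡ c ⊔ d → (a ≡ c × b ≡ d) ⊎ (a ≡ d × b ≡ c)
⊓-⊔-unordered a b c d ⊓≡ ⊔≡ with ≤-total a b | ≤-total c d
... | inj₁ a≤b | inj₁ c≤d = inj₁ (trans (sym (m≤n⇒m⊓n≡m a≤b)) (trans ⊓≡ (m≤n⇒m⊓n≡m c≤d)) ,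
                                  trans (sym (m≤n⇒m⊔n≡n a≤b)) (trans ⊔≡ (m≤n⇒m⊔n≡n c≤d)))
... | inj₁ a≤b | inj₂ d≤c = inj₂ (trans (sym (m≤n⇒m⊓n≡m a≤b)) (trans ⊓≡ (m≥n⇒m⊓n≡n d≤c)) ,
                                  trans (sym (m≤n⇒m⊔n≡n a≤b)) (trans ⊔≡ (m≥n⇒m⊔n≡m d≤c)))
... | inj₂ b≤a | inj₁ c≤d = inj₂ (trans (sym (m≥n⇒m⊔n≡m b≤a)) (trans ⊔≡ (m≤n⇒m⊔n≡n c≤d)) ,
                                  trans (sym (m≥n⇒m⊓n≡n b≤a)) (trans ⊓≡ (m≤n⇒m⊓n≡m c≤d)))
... | inj₂ b≤a | inj₂ d≤c = inj₁ (trans (sym (m≥n⇒m⊔n≡m b≤a)) (trans ⊔≡ (m≥n⇒m⊔n≡m d≤c)) ,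
                                  trans (sym (m≥n⇒m⊓n≡n b≤a)) (trans ⊓≡ (m≥n⇒m⊓n≡n d≤c)))

module _ {n : ℕ} .{{_ : NonZero n}} where

  pairCode%n : ∀ z z' → z < n → pairCode n z z' % n ≡ z ⊓ z'
  pairCode%n z z' z<n = begin
    (z ⊓ z' + n * (z ⊔ z')) % n ≡⟨ cong (λ r → (z ⊓ z' + r) % n) (*-comm n (z ⊔ z')) ⟩
    (z ⊓ z' + (z ⊔ z') * n) % n ≡⟨ [m+kn]%n≡m%n (z ⊓ z') (z ⊔ z') n ⟩
    (z ⊓ z') % n                ≡⟨ m<n⇒m%n≡m (≤-<-trans (m⊓n≤m z z') z<n) ⟩
    z ⊓ z'                      ∎
    where open ≡-Reasoning

  pairCode/n : ∀ z z' → z < n → pairCode n z z' / n ≡ z ⊔ z'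
  pairCode/n z z' z<n = begin
    (z ⊓ z' + n * (z ⊔ z')) / n       ≡⟨ cong (λ r → (z ⊓ z' + r) / n) (*-comm n (z ⊔ z')) ⟩
    (z ⊓ z' + (z ⊔ z') * n) / n       ≡⟨ +-distrib-/ (z ⊓ z') ((z ⊔ z') * n) remainders<n ⟩
    (z ⊓ z') / n + (z ⊔ z') * n / n   ≡⟨ cong₂ _+_ (m<n⇒m/n≡0 min<n) (m*n/n≡m (z ⊔ z') n) ⟩
    z ⊔ z'                            ∎
    where
    open ≡-Reasoning
    min<n : z ⊓ z' < n
    min<n = ≤-<-trans (m⊓n≤m z z') z<n
    remainders<n : (z ⊓ z') % n + ((z ⊔ z') * n) % n < n
    remainders<n = subst₂ (λ r s → r + s < n) (sym (m<n⇒m%n≡m min<n)) (sym (m*n%n≡0 (z ⊔ z') n))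
                     (subst (_< n) (sym (+-identityʳ (z ⊓ z'))) min<n)

  pairCode-injective : ∀ {a b c d} → a < n → c < n → pairCode n a b ≡ pairCode n c d →
                       (a ≡ c × b ≡ d) ⊎ (a ≡ d × b ≡ c)
  pairCode-injective {a} {b} {c} {d} a<n c<n eq = ⊓-⊔-unordered a b c d
    (trans (sym (pairCode%n a b a<n)) (trans (cong (_% n) eq) (pairCode%n c d c<n)))
    (trans (sym (pairCode/n a b a<n)) (trans (cong (_/ n) eq) (pairCode/n c d c<n)))

  pairCode-≢ : ∀ {a b c d} → a < n → c < n → a ≢ c → a ≢ d → pairCode n a b ≢ pairCode n c d
  pairCode-≢ a<n c<n a≢c a≢d eq with pairCode-injective a<n c<n eq
  ... | inj₁ (a≡c , _) = a≢c a≡c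
  ... | inj₂ (a≡d , _) = a≢d a≡d

  pairCode-≢′ : ∀ {a b c d} → b < n → c < n → b ≢ c → b ≢ d → pairCode n a b ≢ pairCode n c d
  pairCode-≢′ {a} {b} b<n c<n b≢c b≢d eq = pairCode-≢ b<n c<n b≢c b≢d (trans (pairCode-comm n b a) eq)

  pairCode⇒∈digits : ∀ {z z' c} → z < n → pairCode n z z' ≡ c → z ∈ digits n c
  pairCode⇒∈digits {z} {z'} z<n refl with ≤-total z z'
  ... | inj₁ z≤z' = here (sym (trans (pairCode%n z z' z<n) (m≤n⇒m⊓n≡m z≤z')))
  ... | inj₂ z'≤z = there (here (sym (trans (pairCode/n z z' z<n) (m≥n⇒m⊔n≡m z'≤z))))

  ∉digits⇒pairCode≢ : ∀ {z z' c} → z < n → z ∉ digits n c → pairCode n z z' ≢ c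
  ∉digits⇒pairCode≢ z<n z∉ eq = z∉ (pairCode⇒∈digits z<n eq)

toℕ-<⇒≢ : ∀ {n} {z z' : Fin n} → toℕ z < toℕ z' → z ≢ z'
toℕ-<⇒≢ z<z' refl = <-irrefl refl z<z'

toℕ->⇒≢ : ∀ {n} {z z' : Fin n} → toℕ z' < toℕ z → z ≢ z'
toℕ->⇒≢ z'<z refl = <-irrefl refl z'<z

SameEdge : ∀ {A : Set} → A × A → A × A → Set
SameEdge s t = (proj₁ s ≡ proj₁ t × proj₂ s ≡ proj₂ t) ⊎ (proj₁ s ≡ proj₂ t × proj₂ s ≡ proj₁ t)

sameEdge? : ∀ {n} (s t : Fin n × Fin n) → Dec (SameEdge s t)
sameEdge? (z , z') (w , w') = ((z Fin.≟ w) ×-dec (z' Fin.≟ w')) ⊎-dec ((z Fin.≟ w') ×-dec (z' Fin.≟ w))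

SameEdge-sym : ∀ {A : Set} {z z' w w' : A} → SameEdge (z , z') (w , w') → SameEdge (w , w') (z , z')
SameEdge-sym (inj₁ (refl , refl)) = inj₁ (refl , refl)
SameEdge-sym (inj₂ (refl , refl)) = inj₂ (refl , refl)

SameEdge-flip : ∀ {A : Set} {z z' : A} {t : A × A} → SameEdge (z , z') t → SameEdge (z' , z) t
SameEdge-flip (inj₁ (z≡ , z'≡)) = inj₂ (z'≡ , z≡)
SameEdge-flip (inj₂ (z≡ , z'≡)) = inj₁ (z'≡ , z≡)

SameEdge-injective : ∀ {A B : Set} {f : A → B} → Injective _≡_ _≡_ f → ∀ {z z' w w'} →
                     SameEdge (f z , f z') (f w , f w') → SameEdge (z , z') (w , w')
SameEdge-injective f-inj = Sum.map (Product.map f-inj f-inj) (Product.map f-inj f-inj)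

SameEdge-trans : ∀ {A : Set} {z z' w w' v v' : A} →
                 SameEdge (z , z') (w , w') → SameEdge (w , w') (v , v') → SameEdge (z , z') (v , v')
SameEdge-trans (inj₁ (refl , refl)) s                    = s
SameEdge-trans (inj₂ (refl , refl)) (inj₁ (refl , refl)) = inj₂ (refl , refl)
SameEdge-trans (inj₂ (refl , refl)) (inj₂ (refl , refl)) = inj₁ (refl , refl)

HasCol-comm : ∀ {n m} {G : ColGraph n} {e : Fin m → Fin n × Fin n} {cs i z z' c} →
              HasCol G e cs i z z' c → HasCol G e cs i z' z c
HasCol-comm {G = G} {z = z} {z'} (inj₁ col≡)                   = inj₁ (trans (csym G z' z) col≡)
HasCol-comm                      (inj₂ (j , j≤i , inj₁ e≡ , c≡)) = inj₂ (j , j≤i , inj₂ e≡ , c≡)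
HasCol-comm                      (inj₂ (j , j≤i , inj₂ e≡ , c≡)) = inj₂ (j , j≤i , inj₁ e≡ , c≡)

HasCol-SameEdge : ∀ {n m} {G : ColGraph n} {e : Fin m → Fin n × Fin n} {cs i z z' w w' c} →
                  SameEdge (z , z') (w , w') → HasCol G e cs i w w' c → HasCol G e cs i z z' c
HasCol-SameEdge         (inj₁ (refl , refl)) h = h
HasCol-SameEdge {G = G} (inj₂ (refl , refl)) h = HasCol-comm {G = G} h

record BareMiddleP4 {k} (H : Graph k) : Set where
  field
    a u v b : Fin k
    a≢u : a ≢ u
    a≢v : a ≢ v
    a≢b : a ≢ b
    u≢v : u ≢ v
    u≢b : u ≢ b
    v≢b : v ≢ b
    a~u : adj H a u ≡ true
    u~v : adj H u v ≡ true
    v~b : adj H v b ≡ true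
    a≁b : adj H a b ≡ false
    N[u] : ∀ {w} → adj H u w ≡ true → w ≡ a ⊎ w ≡ v
    N[v] : ∀ {w} → adj H v w ≡ true → w ≡ u ⊎ w ≡ b

adj-sym : ∀ {k} (H : Graph k) {h h'} → adj H h h' ≡ true → adj H h' h ≡ true
adj-sym H {h} {h'} hh' = trans (Graph.sym H h' h) hh'

InF⇒BareMiddleP4 : ∀ {k} {H : Graph k} → InF H → BareMiddleP4 H
InF⇒BareMiddleP4 {H = H} (u , v , a , b , du , dv , a≢u , a≢v , a≢b , u≢v , u≢b , v≢b , au , uv , vb , _ , ab , _) =
  record
    { a = a ; u = u ; v = v ; b = b
    ; a≢u = a≢u ; a≢v = a≢v ; a≢b = a≢b ; u≢v = u≢v ; u≢b = u≢b ; v≢b = v≢b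
    ; a~u = au ; u~v = uv ; v~b = vb ; a≁b = ab
    ; N[u] = deg≡2⇒neighbour H du (adj-sym H au) uv a≢v
    ; N[v] = deg≡2⇒neighbour H dv (adj-sym H uv) vb u≢b
    }

CodedClique : ∀ {n} → ℕ → ColGraph n → Set
CodedClique {n} N G = ∀ z z' → N ≤ toℕ z → N ≤ toℕ z' → z ≢ z' → col G z z' ≡ just (pairCode n (toℕ z) (toℕ z'))

record RainbowP4 {n m} (N : ℕ) (G : ColGraph n) (e : Fin m → Fin n × Fin n) (cs : Fin m → ℕ) (i : Fin m) : Set where
  field
    p x y q : Fin n
    p≢x : p ≢ x
    p≢y : p ≢ y
    p≢q : p ≢ q
    x≢y : x ≢ y
    x≢q : x ≢ q
    y≢q : y ≢ q
    N≤p : N ≤ toℕ p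
    N≤q : N ≤ toℕ q
    c₁ c₂ c₃ : ℕ
    px : HasCol G e cs i p x c₁
    xy : HasCol G e cs i x y c₂
    yq : HasCol G e cs i y q c₃
    c₁≢c₂ : c₁ ≢ c₂
    c₁≢c₃ : c₁ ≢ c₃
    c₂≢c₃ : c₂ ≢ c₃
    through : SameEdge (e i) (p , x) ⊎ SameEdge (e i) (x , y) ⊎ SameEdge (e i) (y , q)

module Embedding {k n m : ℕ} {{_ : NonZero n}} {H : Graph k} (P : BareMiddleP4 H) {N : ℕ} (room : N + 11 * k ≤ n)
                 {G : ColGraph n} (clique : CodedClique N G)
                 {e : Fin m → Fin n × Fin n} {cs : Fin m → ℕ} {i : Fin m} (path : RainbowP4 N G e cs i) where

  open BareMiddleP4 P
  open RainbowP4 path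

  forbidden : List ℕ
  forbidden = toℕ p ∷ toℕ x ∷ toℕ y ∷ toℕ q ∷ digits n c₁ ++ digits n c₂ ++ digits n c₃

  digits₁⊆ : digits n c₁ ⊆ forbidden
  digits₁⊆ d∈ = there (there (there (there (∈-++⁺ˡ d∈))))

  digits₂⊆ : digits n c₂ ⊆ forbidden
  digits₂⊆ d∈ = there (there (there (there (∈-++⁺ʳ (digits n c₁) (∈-++⁺ˡ d∈)))))

  digits₃⊆ : digits n c₃ ⊆ forbidden
  digits₃⊆ d∈ = there (there (there (there (∈-++⁺ʳ (digits n c₁) (∈-++⁺ʳ (digits n c₂) d∈)))))

  residue : ℕ → ℕ
  residue f = (f ∸ N) % 11

  -- Eleven residues against ten forbidden values.
  free : ∃[ t ] t ≤ 10 × t ∉ map residue forbidden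
  free = fresh≤ 10 (map residue forbidden) ≤-refl

  t : ℕ
  t = proj₁ free

  blockValue : Fin k → ℕ
  blockValue w = N + (t + 11 * toℕ w)

  blockValue<n : ∀ w → blockValue w < n
  blockValue<n w = ≤-trans (+-monoʳ-< N (begin-strict
    t + 11 * toℕ w   <⟨ +-monoˡ-< (11 * toℕ w) (s≤s (proj₁ (proj₂ free))) ⟩
    11 + 11 * toℕ w  ≡⟨ *-suc 11 (toℕ w) ⟨
    11 * suc (toℕ w) ≤⟨ *-monoʳ-≤ 11 (toℕ<n w) ⟩
    11 * k           ∎)) room
    where open ≤-Reasoning

  block : Fin k → Fin n
  block w = fromℕ< (blockValue<n w)

  InBlock : Fin n → Set
  InBlock z = ∃[ w ] toℕ z ≡ blockValue w

  block-InBlock : ∀ w → InBlock (block w)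
  block-InBlock w = w , toℕ-fromℕ< (blockValue<n w)

  block-injective : Injective _≡_ _≡_ block
  block-injective {w} {w'} eq = toℕ-injective (*-cancelˡ-≡ (toℕ w) (toℕ w') 11
    (+-cancelˡ-≡ t _ _ (+-cancelˡ-≡ N _ _
      (trans (sym (toℕ-fromℕ< (blockValue<n w))) (trans (cong toℕ eq) (toℕ-fromℕ< (blockValue<n w')))))))

  N≤InBlock : ∀ {z} → InBlock z → N ≤ toℕ z
  N≤InBlock (w , eq) = subst (N ≤_) (sym eq) (m≤m+n N _)

  residue-blockValue : ∀ w → residue (blockValue w) ≡ t
  residue-blockValue w = begin
    (N + (t + 11 * toℕ w) ∸ N) % 11 ≡⟨ cong (_% 11) (m+n∸m≡n N _) ⟩
    (t + 11 * toℕ w) % 11           ≡⟨ cong (λ r → (t + r) % 11) (*-comm 11 (toℕ w)) ⟩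
    (t + toℕ w * 11) % 11           ≡⟨ [m+kn]%n≡m%n t (toℕ w) 11 ⟩
    t % 11                          ≡⟨ m<n⇒m%n≡m (s≤s (proj₁ (proj₂ free))) ⟩
    t                               ∎
    where open ≡-Reasoning

  InBlock∉forbidden : ∀ {z} → InBlock z → toℕ z ∉ forbidden
  InBlock∉forbidden (w , eq) z∈ = proj₂ (proj₂ free)
    (subst (_∈ map residue forbidden) (trans (cong residue eq) (residue-blockValue w)) (∈-map⁺ residue z∈))

  InBlock⇒≢ : ∀ {z w} → InBlock z → toℕ w ∈ forbidden → z ≢ w
  InBlock⇒≢ bz w∈ refl = InBlock∉forbidden bz w∈

  N≤block : ∀ w → N ≤ toℕ (block w)
  N≤block w = N≤InBlock (block-InBlock w)

  block≢ : ∀ w {z} → toℕ z ∈ forbidden → block w ≢ z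
  block≢ w = InBlock⇒≢ (block-InBlock w)

  Touches : Fin n → Fin n → Set
  Touches z z' = InBlock z ⊎ InBlock z'

  Touches⇒pairCode≢ : ∀ {z z' c} → Touches z z' → digits n c ⊆ forbidden → pairCode n (toℕ z) (toℕ z') ≢ c
  Touches⇒pairCode≢ (inj₁ bz) ⊆f = ∉digits⇒pairCode≢ (toℕ<n _) (InBlock∉forbidden bz ∘ ⊆f)
  Touches⇒pairCode≢ {z} {z'} (inj₂ bz') ⊆f eq =
    ∉digits⇒pairCode≢ (toℕ<n z') (InBlock∉forbidden bz' ∘ ⊆f) (trans (pairCode-comm n (toℕ z') (toℕ z)) eq)

  Touches⇒¬SameEdge : ∀ {z z' w w'} → Touches z z' → toℕ w ∈ forbidden → toℕ w' ∈ forbidden →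
                      ¬ SameEdge (z , z') (w , w')
  Touches⇒¬SameEdge (inj₁ bz)  w∈ w'∈ (inj₁ (z≡ , _)) = InBlock⇒≢ bz w∈ z≡
  Touches⇒¬SameEdge (inj₁ bz)  w∈ w'∈ (inj₂ (z≡ , _)) = InBlock⇒≢ bz w'∈ z≡
  Touches⇒¬SameEdge (inj₂ bz') w∈ w'∈ (inj₁ (_ , z'≡)) = InBlock⇒≢ bz' w'∈ z'≡
  Touches⇒¬SameEdge (inj₂ bz') w∈ w'∈ (inj₂ (_ , z'≡)) = InBlock⇒≢ bz' w∈ z'≡

  p∈ : toℕ p ∈ forbidden
  p∈ = here refl

  x∈ : toℕ x ∈ forbidden
  x∈ = there (here refl)

  y∈ : toℕ y ∈ forbidden
  y∈ = there (there (here refl))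

  q∈ : toℕ q ∈ forbidden
  q∈ = there (there (there (here refl)))

  px≁xy : ¬ SameEdge (p , x) (x , y)
  px≁xy (inj₁ (p≡x , _)) = p≢x p≡x
  px≁xy (inj₂ (p≡y , _)) = p≢y p≡y

  px≁yq : ¬ SameEdge (p , x) (y , q)
  px≁yq (inj₁ (p≡y , _)) = p≢y p≡y
  px≁yq (inj₂ (p≡q , _)) = p≢q p≡q

  xy≁yq : ¬ SameEdge (x , y) (y , q)
  xy≁yq (inj₁ (x≡y , _)) = x≢y x≡y
  xy≁yq (inj₂ (x≡q , _)) = x≢q x≡q

  colour : Fin n → Fin n → ℕ
  colour z z' with sameEdge? (z , z') (p , x) | sameEdge? (z , z') (x , y) | sameEdge? (z , z') (y , q)
  ... | yes _ | _     | _     = c₁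
  ... | no _  | yes _ | _     = c₂
  ... | no _  | no _  | yes _ = c₃
  ... | no _  | no _  | no _  = pairCode n (toℕ z) (toℕ z')

  colour-px : ∀ {z z'} → SameEdge (z , z') (p , x) → colour z z' ≡ c₁
  colour-px {z} {z'} s with sameEdge? (z , z') (p , x)
  ... | yes _ = refl
  ... | no ¬s = ⊥-elim (¬s s)

  colour-xy : ∀ {z z'} → SameEdge (z , z') (x , y) → colour z z' ≡ c₂
  colour-xy {z} {z'} s with sameEdge? (z , z') (p , x) | sameEdge? (z , z') (x , y)
  ... | yes s₁ | _     = ⊥-elim (px≁xy (SameEdge-trans (SameEdge-sym s₁) s))
  ... | no _   | yes _ = refl
  ... | no _   | no ¬s = ⊥-elim (¬s s)

  colour-yq : ∀ {z z'} → SameEdge (z , z') (y , q) → colour z z' ≡ c₃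
  colour-yq {z} {z'} s with sameEdge? (z , z') (p , x) | sameEdge? (z , z') (x , y) | sameEdge? (z , z') (y , q)
  ... | yes s₁ | _      | _     = ⊥-elim (px≁yq (SameEdge-trans (SameEdge-sym s₁) s))
  ... | no _   | yes s₂ | _     = ⊥-elim (xy≁yq (SameEdge-trans (SameEdge-sym s₂) s))
  ... | no _   | no _   | yes _ = refl
  ... | no _   | no _   | no ¬s = ⊥-elim (¬s s)

  colour-Touches : ∀ {z z'} → Touches z z' → colour z z' ≡ pairCode n (toℕ z) (toℕ z')
  colour-Touches {z} {z'} bz with sameEdge? (z , z') (p , x) | sameEdge? (z , z') (x , y) | sameEdge? (z , z') (y , q)
  ... | yes s | _     | _     = ⊥-elim (Touches⇒¬SameEdge bz p∈ x∈ s)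
  ... | no _  | yes s | _     = ⊥-elim (Touches⇒¬SameEdge bz x∈ y∈ s)
  ... | no _  | no _  | yes s = ⊥-elim (Touches⇒¬SameEdge bz y∈ q∈ s)
  ... | no _  | no _  | no _  = refl

  data ImageEdge (z z' : Fin n) : Set where
    first    : SameEdge (z , z') (p , x) → ImageEdge z z'
    middle   : SameEdge (z , z') (x , y) → ImageEdge z z'
    last     : SameEdge (z , z') (y , q) → ImageEdge z z'
    coreEdge : Touches z z' → N ≤ toℕ z → N ≤ toℕ z' → z ≢ z' → ImageEdge z z'

  ImageEdge-sym : ∀ {z z'} → ImageEdge z z' → ImageEdge z' z
  ImageEdge-sym (first s)  = first (SameEdge-flip s)
  ImageEdge-sym (middle s) = middle (SameEdge-flip s)
  ImageEdge-sym (last s)   = last (SameEdge-flip s)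
  ImageEdge-sym (coreEdge bz N≤z N≤z' z≢z') = coreEdge (Sum.swap bz) N≤z' N≤z (≢-sym z≢z')

  ImageEdge-colour : ∀ {z z'} → ImageEdge z z' → HasCol G e cs i z z' (colour z z')
  ImageEdge-colour (first s)  = subst (HasCol G e cs i _ _) (sym (colour-px s)) (HasCol-SameEdge {G = G} s px)
  ImageEdge-colour (middle s) = subst (HasCol G e cs i _ _) (sym (colour-xy s)) (HasCol-SameEdge {G = G} s xy)
  ImageEdge-colour (last s)   = subst (HasCol G e cs i _ _) (sym (colour-yq s)) (HasCol-SameEdge {G = G} s yq)
  ImageEdge-colour {z} {z'} (coreEdge bz N≤z N≤z' z≢z') =
    inj₁ (trans (clique z z' N≤z N≤z' z≢z') (cong just (sym (colour-Touches bz))))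

  ImageEdge-rainbow : ∀ {z₁ z₁' z₂ z₂'} → ImageEdge z₁ z₁' → ImageEdge z₂ z₂' →
                      colour z₁ z₁' ≡ colour z₂ z₂' → SameEdge (z₁ , z₁') (z₂ , z₂')
  ImageEdge-rainbow (first s)  (first s')  _  = SameEdge-trans s (SameEdge-sym s')
  ImageEdge-rainbow (middle s) (middle s') _  = SameEdge-trans s (SameEdge-sym s')
  ImageEdge-rainbow (last s)   (last s')   _  = SameEdge-trans s (SameEdge-sym s')
  ImageEdge-rainbow (first s)  (middle s') eq = ⊥-elim (c₁≢c₂ (trans (sym (colour-px s)) (trans eq (colour-xy s'))))
  ImageEdge-rainbow (first s)  (last s')   eq = ⊥-elim (c₁≢c₃ (trans (sym (colour-px s)) (trans eq (colour-yq s'))))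
  ImageEdge-rainbow (middle s) (first s')  eq = ⊥-elim (c₁≢c₂ (trans (sym (colour-px s')) (trans (sym eq) (colour-xy s))))
  ImageEdge-rainbow (middle s) (last s')   eq = ⊥-elim (c₂≢c₃ (trans (sym (colour-xy s)) (trans eq (colour-yq s'))))
  ImageEdge-rainbow (last s)   (first s')  eq = ⊥-elim (c₁≢c₃ (trans (sym (colour-px s')) (trans (sym eq) (colour-yq s))))
  ImageEdge-rainbow (last s)   (middle s') eq = ⊥-elim (c₂≢c₃ (trans (sym (colour-xy s')) (trans (sym eq) (colour-yq s))))
  ImageEdge-rainbow (first s)  (coreEdge bz _ _ _) eq =
    ⊥-elim (Touches⇒pairCode≢ bz digits₁⊆ (trans (sym (colour-Touches bz)) (trans (sym eq) (colour-px s))))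
  ImageEdge-rainbow (middle s) (coreEdge bz _ _ _) eq =
    ⊥-elim (Touches⇒pairCode≢ bz digits₂⊆ (trans (sym (colour-Touches bz)) (trans (sym eq) (colour-xy s))))
  ImageEdge-rainbow (last s)   (coreEdge bz _ _ _) eq =
    ⊥-elim (Touches⇒pairCode≢ bz digits₃⊆ (trans (sym (colour-Touches bz)) (trans (sym eq) (colour-yq s))))
  ImageEdge-rainbow (coreEdge bz _ _ _) (first s)  eq =
    ⊥-elim (Touches⇒pairCode≢ bz digits₁⊆ (trans (sym (colour-Touches bz)) (trans eq (colour-px s))))
  ImageEdge-rainbow (coreEdge bz _ _ _) (middle s) eq =
    ⊥-elim (Touches⇒pairCode≢ bz digits₂⊆ (trans (sym (colour-Touches bz)) (trans eq (colour-xy s))))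
  ImageEdge-rainbow (coreEdge bz _ _ _) (last s)   eq =
    ⊥-elim (Touches⇒pairCode≢ bz digits₃⊆ (trans (sym (colour-Touches bz)) (trans eq (colour-yq s))))
  ImageEdge-rainbow {z₁} {z₁'} {z₂} {z₂'} (coreEdge bz _ _ _) (coreEdge bz' _ _ _) eq
    with pairCode-injective (toℕ<n z₁) (toℕ<n z₂) (trans (sym (colour-Touches bz)) (trans eq (colour-Touches bz')))
  ... | inj₁ (eq₁ , eq₂) = inj₁ (toℕ-injective eq₁ , toℕ-injective eq₂)
  ... | inj₂ (eq₁ , eq₂) = inj₂ (toℕ-injective eq₁ , toℕ-injective eq₂)

  data Role (h : Fin k) : Set where
    isA   : h ≡ a → Role h
    isU   : h ≡ u → Role h
    isV   : h ≡ v → Role h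
    isB   : h ≡ b → Role h
    other : h ≢ a → h ≢ u → h ≢ v → h ≢ b → Role h

  role : ∀ h → Role h
  role h with h Fin.≟ a | h Fin.≟ u | h Fin.≟ v | h Fin.≟ b
  ... | yes h≡a | _       | _       | _       = isA h≡a
  ... | no _    | yes h≡u | _       | _       = isU h≡u
  ... | no _    | no _    | yes h≡v | _       = isV h≡v
  ... | no _    | no _    | no _    | yes h≡b = isB h≡b
  ... | no h≢a  | no h≢u  | no h≢v  | no h≢b  = other h≢a h≢u h≢v h≢b

  place : ∀ h → Role h → Fin n
  place _ (isA _)         = p
  place _ (isU _)         = x
  place _ (isV _)         = y
  place _ (isB _)         = q
  place h (other _ _ _ _) = block h

  place-irrelevant : ∀ h (r r' : Role h) → place h r ≡ place h r'
  place-irrelevant _ (isA _)         (isA _)         = refl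
  place-irrelevant _ (isU _)         (isU _)         = refl
  place-irrelevant _ (isV _)         (isV _)         = refl
  place-irrelevant _ (isB _)         (isB _)         = refl
  place-irrelevant _ (other _ _ _ _) (other _ _ _ _) = refl
  place-irrelevant _ (isA refl)      (isU e)         = ⊥-elim (a≢u e)
  place-irrelevant _ (isA refl)      (isV e)         = ⊥-elim (a≢v e)
  place-irrelevant _ (isA refl)      (isB e)         = ⊥-elim (a≢b e)
  place-irrelevant _ (isU refl)      (isA e)         = ⊥-elim (a≢u (sym e))
  place-irrelevant _ (isU refl)      (isV e)         = ⊥-elim (u≢v e)
  place-irrelevant _ (isU refl)      (isB e)         = ⊥-elim (u≢b e)
  place-irrelevant _ (isV refl)      (isA e)         = ⊥-elim (a≢v (sym e))
  place-irrelevant _ (isV refl)      (isU e)         = ⊥-elim (u≢v (sym e))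
  place-irrelevant _ (isV refl)      (isB e)         = ⊥-elim (v≢b e)
  place-irrelevant _ (isB refl)      (isA e)         = ⊥-elim (a≢b (sym e))
  place-irrelevant _ (isB refl)      (isU e)         = ⊥-elim (u≢b (sym e))
  place-irrelevant _ (isB refl)      (isV e)         = ⊥-elim (v≢b (sym e))
  place-irrelevant _ (isA e)         (other n _ _ _) = ⊥-elim (n e)
  place-irrelevant _ (isU e)         (other _ n _ _) = ⊥-elim (n e)
  place-irrelevant _ (isV e)         (other _ _ n _) = ⊥-elim (n e)
  place-irrelevant _ (isB e)         (other _ _ _ n) = ⊥-elim (n e)
  place-irrelevant _ (other n _ _ _) (isA e)         = ⊥-elim (n e)
  place-irrelevant _ (other _ n _ _) (isU e)         = ⊥-elim (n e)
  place-irrelevant _ (other _ _ n _) (isV e)         = ⊥-elim (n e)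
  place-irrelevant _ (other _ _ _ n) (isB e)         = ⊥-elim (n e)

  place-injective : ∀ {h h'} (r : Role h) (r' : Role h') → place h r ≡ place h' r' → h ≡ h'
  place-injective (isA refl)      (isA refl)      _  = refl
  place-injective (isU refl)      (isU refl)      _  = refl
  place-injective (isV refl)      (isV refl)      _  = refl
  place-injective (isB refl)      (isB refl)      _  = refl
  place-injective (other _ _ _ _) (other _ _ _ _) eq = block-injective eq
  place-injective (isA _)         (isU _)         eq = ⊥-elim (p≢x eq)
  place-injective (isA _)         (isV _)         eq = ⊥-elim (p≢y eq)
  place-injective (isA _)         (isB _)         eq = ⊥-elim (p≢q eq)
  place-injective (isU _)         (isA _)         eq = ⊥-elim (p≢x (sym eq))
  place-injective (isU _)         (isV _)         eq = ⊥-elim (x≢y eq)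
  place-injective (isU _)         (isB _)         eq = ⊥-elim (x≢q eq)
  place-injective (isV _)         (isA _)         eq = ⊥-elim (p≢y (sym eq))
  place-injective (isV _)         (isU _)         eq = ⊥-elim (x≢y (sym eq))
  place-injective (isV _)         (isB _)         eq = ⊥-elim (y≢q eq)
  place-injective (isB _)         (isA _)         eq = ⊥-elim (p≢q (sym eq))
  place-injective (isB _)         (isU _)         eq = ⊥-elim (x≢q (sym eq))
  place-injective (isB _)         (isV _)         eq = ⊥-elim (y≢q (sym eq))
  place-injective {h' = h'} (isA _) (other _ _ _ _) eq = ⊥-elim (block≢ h' p∈ (sym eq))
  place-injective {h' = h'} (isU _) (other _ _ _ _) eq = ⊥-elim (block≢ h' x∈ (sym eq))
  place-injective {h' = h'} (isV _) (other _ _ _ _) eq = ⊥-elim (block≢ h' y∈ (sym eq))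
  place-injective {h' = h'} (isB _) (other _ _ _ _) eq = ⊥-elim (block≢ h' q∈ (sym eq))
  place-injective {h} (other _ _ _ _) (isA _) eq = ⊥-elim (block≢ h p∈ eq)
  place-injective {h} (other _ _ _ _) (isU _) eq = ⊥-elim (block≢ h x∈ eq)
  place-injective {h} (other _ _ _ _) (isV _) eq = ⊥-elim (block≢ h y∈ eq)
  place-injective {h} (other _ _ _ _) (isB _) eq = ⊥-elim (block≢ h q∈ eq)

  φ : Fin k → Fin n
  φ h = place h (role h)

  φ-injective : Injective _≡_ _≡_ φ
  φ-injective {h} {h'} = place-injective (role h) (role h')

  φa≡p : φ a ≡ p
  φa≡p = place-irrelevant a (role a) (isA refl)

  φu≡x : φ u ≡ x
  φu≡x = place-irrelevant u (role u) (isU refl)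

  φv≡y : φ v ≡ y
  φv≡y = place-irrelevant v (role v) (isV refl)

  φb≡q : φ b ≡ q
  φb≡q = place-irrelevant b (role b) (isB refl)

  irrefl-adj : ∀ {h} → adj H h h ≢ true
  irrefl-adj {h} hh with () ← trans (sym hh) (irrefl H h)

  image-from-u : ∀ {h'} (r' : Role h') → adj H u h' ≡ true → ImageEdge x (place h' r')
  image-from-u r' uh' with N[u] uh'
  ... | inj₁ refl = subst (ImageEdge x) (place-irrelevant a (isA refl) r') (first (inj₂ (refl , refl)))
  ... | inj₂ refl = subst (ImageEdge x) (place-irrelevant v (isV refl) r') (middle (inj₁ (refl , refl)))

  image-from-v : ∀ {h'} (r' : Role h') → adj H v h' ≡ true → ImageEdge y (place h' r')
  image-from-v r' vh' with N[v] vh'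
  ... | inj₁ refl = subst (ImageEdge y) (place-irrelevant u (isU refl) r') (middle (inj₂ (refl , refl)))
  ... | inj₂ refl = subst (ImageEdge y) (place-irrelevant b (isB refl) r') (last (inj₁ (refl , refl)))

  -- Every neighbour of u or v lies on the path, so all other edges of H land in the coded clique.
  image-edge : ∀ {h h'} (r : Role h) (r' : Role h') → adj H h h' ≡ true → ImageEdge (place h r) (place h' r')
  image-edge (isU refl) r'         hh' = image-from-u r' hh'
  image-edge (isV refl) r'         hh' = image-from-v r' hh'
  image-edge r          (isU refl) hh' = ImageEdge-sym (image-from-u r (adj-sym H hh'))
  image-edge r          (isV refl) hh' = ImageEdge-sym (image-from-v r (adj-sym H hh'))
  image-edge (isA refl) (isA refl) hh' = ⊥-elim (irrefl-adj hh')
  image-edge (isB refl) (isB refl) hh' = ⊥-elim (irrefl-adj hh')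
  image-edge (isA refl) (isB refl) hh' with () ← trans (sym hh') a≁b
  image-edge (isB refl) (isA refl) hh' with () ← trans (sym (adj-sym H hh')) a≁b
  image-edge {h' = h'} (isA _) (other _ _ _ _) _ =
    coreEdge (inj₂ (block-InBlock h')) N≤p (N≤block h') (≢-sym (block≢ h' p∈))
  image-edge {h' = h'} (isB _) (other _ _ _ _) _ =
    coreEdge (inj₂ (block-InBlock h')) N≤q (N≤block h') (≢-sym (block≢ h' q∈))
  image-edge {h} (other _ _ _ _) (isA _) _ = coreEdge (inj₁ (block-InBlock h)) (N≤block h) N≤p (block≢ h p∈)
  image-edge {h} (other _ _ _ _) (isB _) _ = coreEdge (inj₁ (block-InBlock h)) (N≤block h) N≤q (block≢ h q∈)
  image-edge {h} {h'} (other _ _ _ _) (other _ _ _ _) hh' =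
    coreEdge (inj₁ (block-InBlock h)) (N≤block h) (N≤block h')
      (λ eq → irrefl-adj (subst (λ w → adj H h w ≡ true) (sym (block-injective eq)) hh'))

  χ : Fin k → Fin k → ℕ
  χ h h' = colour (φ h) (φ h')

  edge-through : ∀ {h h'} → adj H h h' ≡ true → SameEdge (e i) (φ h , φ h') →
                 ∃[ h₁ ] ∃[ h₂ ] (adj H h₁ h₂ ≡ true × (φ h₁ , φ h₂) ≡ e i)
  edge-through {h} {h'} hh' (inj₁ (eq , eq')) = h  , h' , hh' , cong₂ _,_ (sym eq) (sym eq')
  edge-through {h} {h'} hh' (inj₂ (eq , eq')) = h' , h , adj-sym H hh' , cong₂ _,_ (sym eq) (sym eq')

  copy : RainbowCopyWith H G e cs i
  copy = φ , χ , φ-injective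
       , (λ h h' hh' → ImageEdge-colour (image-edge (role h) (role h') hh'))
       , (λ h₁ h₂ h₁' h₂' adj₁ adj₂ eq → SameEdge-injective φ-injective
            (ImageEdge-rainbow (image-edge (role h₁) (role h₂) adj₁) (image-edge (role h₁') (role h₂') adj₂) eq))
       , contains through
    where
    contains : SameEdge (e i) (p , x) ⊎ SameEdge (e i) (x , y) ⊎ SameEdge (e i) (y , q) →
               ∃[ h₁ ] ∃[ h₂ ] (adj H h₁ h₂ ≡ true × (φ h₁ , φ h₂) ≡ e i)
    contains (inj₁ s)        = edge-through a~u (subst₂ (λ z z' → SameEdge (e i) (z , z')) (sym φa≡p) (sym φu≡x) s)
    contains (inj₂ (inj₁ s)) = edge-through u~v (subst₂ (λ z z' → SameEdge (e i) (z , z')) (sym φu≡x) (sym φv≡y) s)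
    contains (inj₂ (inj₂ s)) = edge-through v~b (subst₂ (λ z z' → SameEdge (e i) (z , z')) (sym φv≡y) (sym φb≡q) s)

∑ : ℕ → (ℕ → ℕ) → ℕ
∑ zero    g = 0
∑ (suc n) g = g 0 + ∑ n (g ∘ suc)

syntax ∑ n (λ j → g) = ∑[ j < n ] g

∑-split : ∀ a b g → ∑ (a + b) g ≡ ∑ a g + ∑[ j < b ] g (a + j)
∑-split zero    b g = refl
∑-split (suc a) b g = trans (cong (g 0 +_) (∑-split a b (g ∘ suc))) (sym (+-assoc (g 0) _ _))

∑-mono-≤ : ∀ n {g h} → (∀ j → j < n → g j ≤ h j) → ∑ n g ≤ ∑ n h
∑-mono-≤ zero    _   = z≤n
∑-mono-≤ (suc n) g≤h = +-mono-≤ (g≤h 0 (s≤s z≤n)) (∑-mono-≤ n (λ j j<n → g≤h (suc j) (s≤s j<n)))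

∑≤* : ∀ n {g c} → (∀ j → g j ≤ c) → ∑ n g ≤ n * c
∑≤* zero    _   = z≤n
∑≤* (suc n) g≤c = +-mono-≤ (g≤c 0) (∑≤* n (g≤c ∘ suc))

∑-distrib-+ : ∀ n g h → ∑[ j < n ] (g j + h j) ≡ ∑ n g + ∑ n h
∑-distrib-+ zero    g h = refl
∑-distrib-+ (suc n) g h = trans (cong (g 0 + h 0 +_) (∑-distrib-+ n (g ∘ suc) (h ∘ suc)))
                                (+-interchange (g 0) (h 0) _ _)

2*∑≤3*n+1 : ∀ n g → (∀ j → j < n → g j ≤ 2) → (∀ j → suc j < n → g j + g (suc j) ≤ 3) → 2 * ∑ n g ≤ 3 * n + 1
2*∑≤3*n+1 zero          g _   _   = z≤n
2*∑≤3*n+1 (suc zero)    g ≤2 _   = ≤-trans (≤-reflexive (cong (2 *_) (+-identityʳ (g 0)))) (*-monoʳ-≤ 2 (≤2 0 (s≤s z≤n)))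
2*∑≤3*n+1 (suc (suc n)) g ≤2 ≤3 = begin
  2 * (g 0 + (g 1 + rest))     ≡⟨ cong (2 *_) (+-assoc (g 0) (g 1) rest) ⟨
  2 * (g 0 + g 1 + rest)       ≡⟨ *-distribˡ-+ 2 (g 0 + g 1) rest ⟩
  2 * (g 0 + g 1) + 2 * rest   ≤⟨ +-mono-≤ (*-monoʳ-≤ 2 (≤3 0 (s≤s (s≤s z≤n))))
                                           (2*∑≤3*n+1 n (g ∘ suc ∘ suc) (λ j j<n → ≤2 (2 + j) (s≤s (s≤s j<n)))
                                                                        (λ j j<n → ≤3 (2 + j) (s≤s (s≤s j<n)))) ⟩
  6 + (3 * n + 1)              ≡⟨ cong (_+ 1) (*-distribˡ-+ 3 2 n) ⟨
  3 * (2 + n) + 1              ∎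
  where
  open ≤-Reasoning
  rest : ℕ
  rest = ∑ n (g ∘ suc ∘ suc)

count : ℕ → (ℕ → Bool) → ℕ
count n R = ∑[ j < n ] (if R j then 1 else 0)

count≡0 : ∀ n R → (∀ j → j < n → ¬ T (R j)) → count n R ≡ 0
count≡0 zero    R none = refl
count≡0 (suc n) R none with R 0 in R0
... | true  = ⊥-elim (none 0 (s≤s z≤n) (subst T (sym R0) tt))
... | false = count≡0 n (R ∘ suc) (λ j j<n → none (suc j) (s≤s j<n))

count≤n : ∀ n R → count n R ≤ n
count≤n n R = ≤-trans (∑≤* n indicator≤1) (≤-reflexive (*-identityʳ n))
  where
  indicator≤1 : ∀ j → (if R j then 1 else 0) ≤ 1
  indicator≤1 j with R j
  ... | true  = ≤-refl
  ... | false = z≤n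

count≤1 : ∀ n R c → (∀ j → T (R j) → j ≡ c) → count n R ≤ 1
count≤1 zero    R c only-c = z≤n
count≤1 (suc n) R c only-c with R 0 in R0
... | false = count≤1 n (R ∘ suc) (c ∸ 1) λ j Rj → cong (_∸ 1) (only-c (suc j) Rj)
... | true  = s≤s (≤-reflexive (count≡0 n (R ∘ suc)
                λ j _ Rj → 0≢1+n (trans (only-c 0 (subst T (sym R0) tt)) (sym (only-c (suc j) Rj)))))

count≤2 : ∀ n R c d → (∀ j → T (R j) → j ≡ c ⊎ j ≡ d) → count n R ≤ 2
count≤2 n R c d c-or-d = begin
  count n R                                             ≤⟨ ∑-mono-≤ n split ⟩
  ∑[ j < n ] (indicator (j ≡ᵇ c) + indicator (j ≡ᵇ d)) ≡⟨ ∑-distrib-+ n _ _ ⟩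
  count n (_≡ᵇ c) + count n (_≡ᵇ d)                     ≤⟨ +-mono-≤ (count≤1 n (_≡ᵇ c) c (λ j → ≡ᵇ⇒≡ j c))
                                                                    (count≤1 n (_≡ᵇ d) d (λ j → ≡ᵇ⇒≡ j d)) ⟩
  2                                                     ∎
  where
  open ≤-Reasoning
  indicator : Bool → ℕ
  indicator b = if b then 1 else 0
  1≤indicator : ∀ {b} → T b → 1 ≤ indicator b
  1≤indicator {true} _ = ≤-refl
  split : ∀ j → j < n → indicator (R j) ≤ indicator (j ≡ᵇ c) + indicator (j ≡ᵇ d)
  split j _ with R j in Rj
  ... | false = z≤n
  ... | true with c-or-d j (subst T (sym Rj) tt)
  ...   | inj₁ refl = ≤-trans (1≤indicator (≡⇒≡ᵇ j j refl)) (m≤m+n _ _)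
  ...   | inj₂ refl = ≤-trans (1≤indicator (≡⇒≡ᵇ j j refl)) (m≤n+m _ _)

length-filterᵇ-map : ∀ {A B : Set} (f : B → Bool) (g : A → B) xs →
                     length (filterᵇ f (map g xs)) ≡ length (filterᵇ (f ∘ g) xs)
length-filterᵇ-map f g []       = refl
length-filterᵇ-map f g (x ∷ xs) with f (g x)
... | true  = cong suc (length-filterᵇ-map f g xs)
... | false = length-filterᵇ-map f g xs

module _ {A B : Set} where

  length-filterᵇ-cartesianProduct : ∀ (f : A × B → Bool) xs ys →
    length (filterᵇ f (cartesianProduct xs ys)) ≡ sum (map (λ x → length (filterᵇ (λ y → f (x , y)) ys)) xs)
  length-filterᵇ-cartesianProduct f []       ys = refl
  length-filterᵇ-cartesianProduct f (x ∷ xs) ys = begin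
    length (filterᵇ f (map (x ,_) ys ++ cartesianProduct xs ys))
      ≡⟨ cong length (filter-++ (T? ∘ f) (map (x ,_) ys) (cartesianProduct xs ys)) ⟩
    length (filterᵇ f (map (x ,_) ys) ++ filterᵇ f (cartesianProduct xs ys))
      ≡⟨ length-++ (filterᵇ f (map (x ,_) ys)) ⟩
    length (filterᵇ f (map (x ,_) ys)) + length (filterᵇ f (cartesianProduct xs ys))
      ≡⟨ cong₂ _+_ (length-filterᵇ-map f (x ,_) ys) (length-filterᵇ-cartesianProduct f xs ys) ⟩
    length (filterᵇ (λ y → f (x , y)) ys) + sum (map (λ x → length (filterᵇ (λ y → f (x , y)) ys)) xs)
      ∎
    where open ≡-Reasoning

  length-cartesianProduct : ∀ (xs : List A) (ys : List B) → length (cartesianProduct xs ys) ≡ length xs * length ys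
  length-cartesianProduct []       ys = refl
  length-cartesianProduct (x ∷ xs) ys = trans (length-++ (map (x ,_) ys))
    (cong₂ _+_ (length-map (x ,_) ys) (length-cartesianProduct xs ys))

module _ {A : Set} where

  length-filterᵇ-tabulate : ∀ n (g : Fin n → A) (P : A → Bool) (R : ℕ → Bool) → (∀ j → P (g j) ≡ R (toℕ j)) →
                            length (filterᵇ P (tabulate g)) ≡ count n R
  length-filterᵇ-tabulate zero    g P R P≡R = refl
  length-filterᵇ-tabulate (suc n) g P R P≡R with P (g Fin.zero) | R 0 | P≡R Fin.zero
  ... | true  | true  | _ = cong suc (length-filterᵇ-tabulate n (g ∘ Fin.suc) P (R ∘ suc) (P≡R ∘ Fin.suc))
  ... | false | false | _ = length-filterᵇ-tabulate n (g ∘ Fin.suc) P (R ∘ suc) (P≡R ∘ Fin.suc)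

  sum-map-tabulate : ∀ n (g : Fin n → A) (h : A → ℕ) (k : ℕ → ℕ) → (∀ j → h (g j) ≡ k (toℕ j)) →
                     sum (map h (tabulate g)) ≡ ∑ n k
  sum-map-tabulate zero    g h k h≡k = refl
  sum-map-tabulate (suc n) g h k h≡k =
    cong₂ _+_ (h≡k Fin.zero) (sum-map-tabulate n (g ∘ Fin.suc) h (k ∘ suc) (h≡k ∘ Fin.suc))

length-filterᵇ-allPairs : ∀ n (f : Fin n × Fin n → Bool) (R : ℕ → ℕ → Bool) → (∀ x y → f (x , y) ≡ R (toℕ x) (toℕ y)) →
                          length (filterᵇ f (cartesianProduct (allFin n) (allFin n))) ≡ ∑[ lo < n ] count n (R lo)
length-filterᵇ-allPairs n f R f≡R = trans (length-filterᵇ-cartesianProduct f (allFin n) (allFin n))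
  (sum-map-tabulate n id _ (λ lo → count n (R lo))
    (λ x → length-filterᵇ-tabulate n id (λ y → f (x , y)) (R (toℕ x)) (f≡R x)))

eCount≤n*n : ∀ {n} (G : ColGraph n) → eCount G ≤ n * n
eCount≤n*n {n} G = begin
  eCount G                                        ≤⟨ length-filter _ (cartesianProduct (allFin n) (allFin n)) ⟩
  length (cartesianProduct (allFin n) (allFin n)) ≡⟨ length-cartesianProduct (allFin n) (allFin n) ⟩
  length (allFin n) * length (allFin n)           ≡⟨ cong₂ _*_ (length-tabulate {n = n} id) (length-tabulate {n = n} id) ⟩
  n * n                                           ∎
  where open ≤-Reasoning

isEven : ℕ → Bool
isEven zero    = true
isEven (suc j) = not (isEven j)

odd⇒suc-even : ∀ X → isEven X ≡ false → ∃[ X' ] X ≡ suc X' × isEven X' ≡ true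
odd⇒suc-even zero    ()
odd⇒suc-even (suc X') odd = X' , refl , not-injective odd

module Host (N s : ℕ) where

  n : ℕ
  n = N + s

  -- For lo < hi: the vertices N, …, N + s - 1 form a clique, the hub α = N is joined to the even outer
  -- vertices and the hub β = N + 1 to the odd ones, outer vertex 2j is matched to 2j + 1, and an
  -- unmatched last outer vertex is joined to both hubs.
  HostEdge : ℕ → ℕ → Set
  HostEdge lo hi = N ≤ lo
                 ⊎ (hi ≡ N × isEven lo ≡ true)
                 ⊎ (hi ≡ suc N × (isEven lo ≡ false ⊎ suc lo ≡ N))
                 ⊎ (hi ≡ suc lo × isEven lo ≡ true × suc hi ≤ N)

  pattern inClique N≤lo             = inj₁ N≤lo
  pattern evenToα hi≡N even         = inj₂ (inj₁ (hi≡N , even))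
  pattern oddToβ hi≡β odd           = inj₂ (inj₂ (inj₁ (hi≡β , inj₁ odd)))
  pattern lastToβ hi≡β last         = inj₂ (inj₂ (inj₁ (hi≡β , inj₂ last)))
  pattern matched hi≡lo+1 even hi<N = inj₂ (inj₂ (inj₂ (hi≡lo+1 , even , hi<N)))

  HostEdge? : ∀ lo hi → Dec (HostEdge lo hi)
  HostEdge? lo hi = N ≤? lo
                  ⊎-dec ((hi ≟ N) ×-dec (isEven lo ≟ᵇ true))
                  ⊎-dec ((hi ≟ suc N) ×-dec ((isEven lo ≟ᵇ false) ⊎-dec (suc lo ≟ N)))
                  ⊎-dec ((hi ≟ suc lo) ×-dec (isEven lo ≟ᵇ true) ×-dec (suc hi ≤? N))

  edgeIf : ℕ → ℕ → ℕ → Maybe ℕ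
  edgeIf lo hi c with (lo <? hi) ×-dec HostEdge? lo hi
  ... | yes _ = just c
  ... | no _  = nothing

  edgeIf-just : ∀ {lo hi} c → lo < hi → HostEdge lo hi → edgeIf lo hi c ≡ just c
  edgeIf-just {lo} {hi} c lo<hi E with (lo <? hi) ×-dec HostEdge? lo hi
  ... | yes _ = refl
  ... | no ¬E = ⊥-elim (¬E (lo<hi , E))

  edgeIf-nothing : ∀ {lo hi} c → ¬ (lo < hi × HostEdge lo hi) → edgeIf lo hi c ≡ nothing
  edgeIf-nothing {lo} {hi} c ¬E with (lo <? hi) ×-dec HostEdge? lo hi
  ... | yes E = ⊥-elim (¬E E)
  ... | no _  = refl

  edgeIf-is-just : ∀ {lo hi} c → T (is-just (edgeIf lo hi c)) → lo < hi × HostEdge lo hi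
  edgeIf-is-just {lo} {hi} c with (lo <? hi) ×-dec HostEdge? lo hi
  ... | yes E = λ _ → E
  ... | no _  = λ ()

  hostCol : ℕ → ℕ → Maybe ℕ
  hostCol z z' = edgeIf (z ⊓ z') (z ⊔ z') (pairCode n z z')

  hostCol-comm : ∀ z z' → hostCol z z' ≡ hostCol z' z
  hostCol-comm z z' = trans (cong₂ (λ lo hi → edgeIf lo hi (pairCode n z z')) (⊓-comm z z') (⊔-comm z z'))
                            (cong (edgeIf (z' ⊓ z) (z' ⊔ z)) (pairCode-comm n z z'))

  hostCol-irrefl : ∀ z → hostCol z z ≡ nothing
  hostCol-irrefl z = edgeIf-nothing _ λ (lt , _) → <-irrefl (trans (⊓-idem z) (sym (⊔-idem z))) lt

  G : ColGraph n
  G = record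
    { col  = λ z z' → hostCol (toℕ z) (toℕ z')
    ; csym = λ z z' → hostCol-comm (toℕ z) (toℕ z')
    ; cirr = λ z → hostCol-irrefl (toℕ z)
    }

  hostCol-< : ∀ {lo hi} → lo < hi → hostCol lo hi ≡ edgeIf lo hi (pairCode n lo hi)
  hostCol-< {lo} {hi} lo<hi = cong₂ (λ l h → edgeIf l h (pairCode n lo hi)) (m≤n⇒m⊓n≡m (<⇒≤ lo<hi)) (m≤n⇒m⊔n≡n (<⇒≤ lo<hi))

  edge< : ∀ {z z'} → toℕ z < toℕ z' → HostEdge (toℕ z) (toℕ z') → col G z z' ≡ just (pairCode n (toℕ z) (toℕ z'))
  edge< z<z' E = trans (hostCol-< z<z') (edgeIf-just _ z<z' E)

  edge> : ∀ {z z'} → toℕ z' < toℕ z → HostEdge (toℕ z') (toℕ z) → col G z z' ≡ just (pairCode n (toℕ z) (toℕ z'))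
  edge> {z} {z'} z'<z E =
    trans (csym G z z') (trans (edge< z'<z E) (cong just (pairCode-comm n (toℕ z') (toℕ z))))

  clique : CodedClique N G
  clique z z' N≤z N≤z' z≢z' with <-cmp (toℕ z) (toℕ z')
  ... | tri< z<z' _ _ = edge< z<z' (inClique N≤z)
  ... | tri≈ _ z≡z' _ = ⊥-elim (z≢z' (toℕ-injective z≡z'))
  ... | tri> _ _ z'<z = edge> z'<z (inClique N≤z')

  nonEdge⇒¬HostEdge : ∀ {z z'} → toℕ z < toℕ z' → col G z z' ≡ nothing → ¬ HostEdge (toℕ z) (toℕ z')
  nonEdge⇒¬HostEdge {z} {z'} z<z' none E with () ← trans (sym (edge< {z} {z'} z<z' E)) none

  ¬HostEdge⇒nonEdge : ∀ {z z'} → toℕ z < toℕ z' → ¬ HostEdge (toℕ z) (toℕ z') → col G z z' ≡ nothing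
  ¬HostEdge⇒nonEdge z<z' ¬E = trans (hostCol-< z<z') (edgeIf-nothing _ (¬E ∘ proj₂))

  upDegree : ℕ → ℕ
  upDegree lo = count n (λ hi → (lo <ᵇ hi) ∧ is-just (hostCol lo hi))

  upEdge : ∀ {lo hi} → T ((lo <ᵇ hi) ∧ is-just (hostCol lo hi)) → lo < hi × HostEdge lo hi
  upEdge {lo} {hi} t with Equivalence.to T-∧ t
  ... | lo<ᵇhi , isJust = edgeIf-is-just _ (subst (T ∘ is-just) (hostCol-< (<ᵇ⇒< lo hi lo<ᵇhi)) isJust)

  upDegree-clique : ∀ {lo} → N ≤ lo → upDegree lo ≤ s
  upDegree-clique {lo} N≤lo = begin
    upDegree lo                                ≡⟨ ∑-split N s _ ⟩
    count N R + count s (λ j → R (N + j))      ≡⟨ cong (_+ count s (λ j → R (N + j))) (count≡0 N R below-N) ⟩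
    count s (λ j → R (N + j))                  ≤⟨ count≤n s _ ⟩
    s                                          ∎
    where
    open ≤-Reasoning
    R : ℕ → Bool
    R hi = (lo <ᵇ hi) ∧ is-just (hostCol lo hi)
    below-N : ∀ hi → hi < N → ¬ T (R hi)
    below-N hi hi<N t = <⇒≱ (<-trans (proj₁ (upEdge t)) hi<N) N≤lo

  upDegree-odd : ∀ {lo} → lo < N → isEven lo ≡ false → upDegree lo ≤ 1
  upDegree-odd {lo} lo<N odd = count≤1 n _ (suc N) λ hi t → only-β (proj₂ (upEdge t))
    where
    only-β : ∀ {hi} → HostEdge lo hi → hi ≡ suc N
    only-β (inClique N≤lo)    = ⊥-elim (<⇒≱ lo<N N≤lo)
    only-β (evenToα _ even)   with () ← trans (sym even) odd
    only-β (oddToβ hi≡β _)    = hi≡β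
    only-β (lastToβ hi≡β _)   = hi≡β
    only-β (matched _ even _) with () ← trans (sym even) odd

  upDegree-even : ∀ {lo} → lo < N → isEven lo ≡ true → upDegree lo ≤ 2
  upDegree-even {lo} lo<N even with suc lo ≟ N
  ... | yes last = count≤2 n _ N (suc N) λ hi t → α-or-β (proj₂ (upEdge t))
    where
    α-or-β : ∀ {hi} → HostEdge lo hi → hi ≡ N ⊎ hi ≡ suc N
    α-or-β (inClique N≤lo)       = ⊥-elim (<⇒≱ lo<N N≤lo)
    α-or-β (evenToα hi≡N _)      = inj₁ hi≡N
    α-or-β (oddToβ _ odd)        with () ← trans (sym even) odd
    α-or-β (lastToβ hi≡β _)      = inj₂ hi≡β
    α-or-β (matched hi≡lo+1 _ _) = inj₁ (trans hi≡lo+1 last)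
  ... | no ¬last = count≤2 n _ N (suc lo) λ hi t → α-or-partner (proj₂ (upEdge t))
    where
    α-or-partner : ∀ {hi} → HostEdge lo hi → hi ≡ N ⊎ hi ≡ suc lo
    α-or-partner (inClique N≤lo)       = ⊥-elim (<⇒≱ lo<N N≤lo)
    α-or-partner (evenToα hi≡N _)      = inj₁ hi≡N
    α-or-partner (oddToβ _ odd)        with () ← trans (sym even) odd
    α-or-partner (lastToβ _ last)      = ⊥-elim (¬last last)
    α-or-partner (matched hi≡lo+1 _ _) = inj₂ hi≡lo+1

  upDegree-outer≤2 : ∀ lo → lo < N → upDegree lo ≤ 2
  upDegree-outer≤2 lo lo<N with isEven lo in parity
  ... | true  = upDegree-even lo<N parity
  ... | false = m≤n⇒m≤1+n (upDegree-odd lo<N parity)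

  upDegree-consecutive≤3 : ∀ lo → suc lo < N → upDegree lo + upDegree (suc lo) ≤ 3
  upDegree-consecutive≤3 lo lo+1<N with isEven lo in parity
  ... | true  = +-mono-≤ (upDegree-even (<-trans (n<1+n lo) lo+1<N) parity) (upDegree-odd lo+1<N (cong not parity))
  ... | false = +-mono-≤ (upDegree-odd (<-trans (n<1+n lo) lo+1<N) parity) (upDegree-even lo+1<N (cong not parity))

  2*eCount≤ : 2 * eCount G ≤ 3 * n + (1 + 2 * (s * s))
  2*eCount≤ = begin
    2 * eCount G                                             ≡⟨ cong (2 *_) eCount≡ ⟩
    2 * ∑ (N + s) upDegree                                   ≡⟨ cong (2 *_) (∑-split N s upDegree) ⟩
    2 * (∑ N upDegree + ∑[ j < s ] upDegree (N + j))         ≡⟨ *-distribˡ-+ 2 (∑ N upDegree) _ ⟩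
    2 * ∑ N upDegree + 2 * ∑[ j < s ] upDegree (N + j)
      ≤⟨ +-mono-≤ (2*∑≤3*n+1 N upDegree upDegree-outer≤2 upDegree-consecutive≤3)
                  (*-monoʳ-≤ 2 (∑≤* s (λ j → upDegree-clique (m≤m+n N j)))) ⟩
    3 * N + 1 + 2 * (s * s)                                  ≡⟨ +-assoc (3 * N) 1 _ ⟩
    3 * N + (1 + 2 * (s * s))                                ≤⟨ +-monoˡ-≤ _ (*-monoʳ-≤ 3 (m≤m+n N s)) ⟩
    3 * n + (1 + 2 * (s * s))                                ∎
    where
    open ≤-Reasoning
    eCount≡ : eCount G ≡ ∑ n upDegree
    eCount≡ = length-filterᵇ-allPairs n _ (λ lo hi → (lo <ᵇ hi) ∧ is-just (hostCol lo hi)) (λ _ _ → refl)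

module _ {A : Set} where

  Unique⇒lookup-injective : ∀ {xs : List A} → Unique xs → Injective _≡_ _≡_ (lookup xs)
  Unique⇒lookup-injective {_ ∷ _}  (_ ∷ _)      {Fin.zero}  {Fin.zero}  _  = refl
  Unique⇒lookup-injective {_ ∷ xs} (x∉ ∷ _)     {Fin.zero}  {Fin.suc j} eq = ⊥-elim (All.lookup x∉ (∈-lookup {xs = xs} j) eq)
  Unique⇒lookup-injective {_ ∷ xs} (x∉ ∷ _)     {Fin.suc j} {Fin.zero}  eq =
    ⊥-elim (All.lookup x∉ (∈-lookup {xs = xs} j) (sym eq))
  Unique⇒lookup-injective {_ ∷ _}  (_ ∷ unique) {Fin.suc _} {Fin.suc _} eq = cong Fin.suc (Unique⇒lookup-injective unique eq)

  lookup-++ : ∀ (xs ys : List A) (j : Fin (length (xs ++ ys))) →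
              (toℕ j < length xs × lookup (xs ++ ys) j ∈ xs) ⊎ (length xs ≤ toℕ j × lookup (xs ++ ys) j ∈ ys)
  lookup-++ []       ys j           = inj₂ (z≤n , ∈-lookup j)
  lookup-++ (x ∷ xs) ys Fin.zero    = inj₁ (s≤s z≤n , here refl)
  lookup-++ (x ∷ xs) ys (Fin.suc j) = Sum.map (Product.map s≤s there) (Product.map s≤s id) (lookup-++ xs ys j)

module PrioritisedEnumeration {A : Set} (xs : List A) (xs-unique : Unique xs)
                              {P Q : A → Set} (P? : Decidable P) (Q? : Decidable Q) where

  opaque
    first second order : List A
    first  = filter (P? ∩? Q?) xs
    second = filter (P? ∩? ∁? Q?) xs
    order  = first ++ second

    size : ℕ
    size = length order

    enum : Fin size → A
    enum = lookup order

    enum-sat : ∀ j → P (enum j)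
    enum-sat j with ∈-++⁻ first (∈-lookup {xs = order} j)
    ... | inj₁ ∈first  = proj₁ (proj₂ (∈-filter⁻ (P? ∩? Q?) {xs = xs} ∈first))
    ... | inj₂ ∈second = proj₁ (proj₂ (∈-filter⁻ (P? ∩? ∁? Q?) {xs = xs} ∈second))

    enum-injective : Injective _≡_ _≡_ enum
    enum-injective = Unique⇒lookup-injective (Unique.++⁺ (Unique.filter⁺ _ xs-unique) (Unique.filter⁺ _ xs-unique) disjoint)
      where
      disjoint : ∀ {a} → a ∈ first × a ∈ second → ⊥
      disjoint (∈first , ∈second) = proj₂ (proj₂ (∈-filter⁻ (P? ∩? ∁? Q?) {xs = xs} ∈second))
                                          (proj₂ (proj₂ (∈-filter⁻ (P? ∩? Q?) {xs = xs} ∈first)))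

    enum-complete : ∀ {a} → a ∈ xs → P a → ∃[ j ] enum j ≡ a
    enum-complete {a} a∈ Pa = index a∈order , sym (lookup-index a∈order)
      where
      a∈order : a ∈ order
      a∈order with Q? a
      ... | yes Qa = ∈-++⁺ˡ (∈-filter⁺ (P? ∩? Q?) a∈ (Pa , Qa))
      ... | no ¬Qa = ∈-++⁺ʳ first (∈-filter⁺ (P? ∩? ∁? Q?) a∈ (Pa , ¬Qa))

    enum-priority : ∀ j i → Q (enum j) → ¬ Q (enum i) → toℕ j ≤ toℕ i
    enum-priority j i Qj ¬Qi with lookup-++ first second j | lookup-++ first second i
    ... | inj₁ (j<∣first∣ , _) | inj₂ (∣first∣≤i , _) = <⇒≤ (<-≤-trans j<∣first∣ ∣first∣≤i)
    ... | inj₁ _ | inj₁ (_ , ∈first) = ⊥-elim (¬Qi (proj₂ (proj₂ (∈-filter⁻ (P? ∩? Q?) {xs = xs} ∈first))))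
    ... | inj₂ (_ , ∈second) | _    = ⊥-elim (proj₂ (proj₂ (∈-filter⁻ (P? ∩? ∁? Q?) {xs = xs} ∈second)) Qj)

module Saturation {k : ℕ} {H : Graph k} (P4 : BareMiddleP4 H) (N : ℕ) where

  open Host N (8 + 11 * k)

  instance
    n-nonZero : NonZero n
    n-nonZero = >-nonZero (≤-trans (s≤s z≤n) (m≤n+m (8 + 11 * k) N))

  room : N + 11 * k ≤ n
  room = +-monoʳ-≤ N (m≤n+m (11 * k) 8)

  N+2+t<n : ∀ {t} → t ≤ 5 → suc (suc N) + t < n
  N+2+t<n {t} t≤5 = begin-strict
    suc (suc N) + t ≤⟨ +-monoʳ-≤ (suc (suc N)) t≤5 ⟩
    suc (suc N) + 5 ≡⟨ cong (suc ∘ suc) (+-comm N 5) ⟩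
    7 + N           <⟨ n<1+n (7 + N) ⟩
    8 + N           ≡⟨ +-comm 8 N ⟩
    N + 8           ≤⟨ +-monoʳ-≤ N (m≤m+n 8 (11 * k)) ⟩
    n               ∎
    where open ≤-Reasoning

  N+2≤n : suc (suc N) ≤ n
  N+2≤n = ≤-trans (≤-reflexive (cong (suc ∘ suc) (sym (+-identityʳ N)))) (<⇒≤ (N+2+t<n {0} z≤n))

  α β : Fin n
  α = fromℕ< (≤-trans (n≤1+n (suc N)) N+2≤n)
  β = fromℕ< N+2≤n

  toℕ-α : toℕ α ≡ N
  toℕ-α = toℕ-fromℕ< _

  toℕ-β : toℕ β ≡ suc N
  toℕ-β = toℕ-fromℕ< _

  hub : Bool → Fin n
  hub true  = α
  hub false = β

  hub-edge : ∀ X → HostEdge X (toℕ (hub (isEven X)))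
  hub-edge X with isEven X
  ... | true  = evenToα toℕ-α refl
  ... | false = oddToβ toℕ-β refl

  N≤hub : ∀ b → N ≤ toℕ (hub b)
  N≤hub true  = ≤-reflexive (sym toℕ-α)
  N≤hub false = ≤-trans (n≤1+n N) (≤-reflexive (sym toℕ-β))

  hub<N+2 : ∀ b → toℕ (hub b) < suc (suc N)
  hub<N+2 true  = s≤s (≤-trans (≤-reflexive toℕ-α) (n≤1+n N))
  hub<N+2 false = s≤s (≤-reflexive toℕ-β)

  pool : ∀ {t} → t ≤ 5 → Fin n
  pool t≤5 = fromℕ< (N+2+t<n t≤5)

  toℕ-pool : ∀ {t} (t≤5 : t ≤ 5) → toℕ (pool t≤5) ≡ suc (suc N) + t
  toℕ-pool t≤5 = toℕ-fromℕ< (N+2+t<n t≤5)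

  N+2≤pool : ∀ {t} (t≤5 : t ≤ 5) → suc (suc N) ≤ toℕ (pool t≤5)
  N+2≤pool {t} t≤5 = ≤-trans (m≤m+n (suc (suc N)) t) (≤-reflexive (sym (toℕ-pool t≤5)))

  N+2≤⇒N≤ : ∀ {z} → suc (suc N) ≤ z → N ≤ z
  N+2≤⇒N≤ N+2≤z = ≤-trans (≤-trans (n≤1+n N) (n≤1+n (suc N))) N+2≤z

  opaque
    choosePool : (L : List ℕ) → length L ≤ 5 → Σ[ q ∈ Fin n ] (suc (suc N) ≤ toℕ q × toℕ q ∉ L)
    choosePool L len with fresh≤ 5 (map (_∸ suc (suc N)) L) (≤-trans (≤-reflexive (length-map _ L)) len)
    ... | t , t≤5 , t∉ = pool t≤5 , N+2≤pool t≤5 , λ q∈L → t∉ (subst (_∈ map (_∸ suc (suc N)) L)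
                            (trans (cong (_∸ suc (suc N)) (toℕ-pool t≤5)) (m+n∸m≡n (suc (suc N)) t)) (∈-map⁺ _ q∈L))

  NonEdge : Fin n × Fin n → Set
  NonEdge pr = toℕ (proj₁ pr) < toℕ (proj₂ pr) × col G (proj₁ pr) (proj₂ pr) ≡ nothing

  NonEdge? : ∀ pr → Dec (NonEdge pr)
  NonEdge? (z , z') = (toℕ z <? toℕ z') ×-dec ≡-dec _≟_ (col G z z') nothing

  Early : Fin n × Fin n → Set
  Early pr = toℕ (proj₁ pr) < N × suc (suc N) ≤ toℕ (proj₂ pr)

  Early? : ∀ pr → Dec (Early pr)
  Early? (z , z') = (toℕ z <? N) ×-dec (suc (suc N) ≤? toℕ z')

  open PrioritisedEnumeration (cartesianProduct (allFin n) (allFin n))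
         (Unique.cartesianProduct⁺ (Unique.allFin⁺ n) (Unique.allFin⁺ n)) NonEdge? Early?

  enum-onto : ∀ z z' → toℕ z < toℕ z' → col G z z' ≡ nothing → ∃[ j ] enum j ≡ (z , z')
  enum-onto z z' z<z' none = enum-complete (∈-cartesianProduct⁺ (∈-allFin z) (∈-allFin z')) (z<z' , none)

  early-NonEdge : ∀ {z w} → Early (z , w) → NonEdge (z , w)
  early-NonEdge {z} {w} (z<N , N+2≤w) = z<w , ¬HostEdge⇒nonEdge z<w ¬E
    where
    z<w : toℕ z < toℕ w
    z<w = <-≤-trans z<N (N+2≤⇒N≤ N+2≤w)
    ¬E : ¬ HostEdge (toℕ z) (toℕ w)
    ¬E (inClique N≤z)       = <⇒≱ z<N N≤z
    ¬E (evenToα w≡N _)      = <⇒≱ (≤-trans (n≤1+n _) N+2≤w) (≤-reflexive w≡N)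
    ¬E (oddToβ w≡β _)       = <⇒≱ N+2≤w (≤-reflexive w≡β)
    ¬E (lastToβ w≡β _)      = <⇒≱ N+2≤w (≤-reflexive w≡β)
    ¬E (matched _ _ w+1≤N)  = <⇒≱ (≤-trans (s≤s (N+2≤⇒N≤ N+2≤w)) w+1≤N) ≤-refl

  earlier : ∀ {z w} i → Early (z , w) → ¬ Early (enum i) → ∃[ j ] (enum j ≡ (z , w) × toℕ j ≤ toℕ i)
  earlier {z} {w} i early late = j , enum-j , enum-priority j i (subst Early (sym enum-j) early) late
    where
    onto : ∃[ j ] enum j ≡ (z , w)
    onto = enum-onto z w (proj₁ (early-NonEdge early)) (proj₂ (early-NonEdge early))
    j : Fin size
    j = proj₁ onto
    enum-j : enum j ≡ (z , w)
    enum-j = proj₂ onto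

  module Step (cs : Fin size → ℕ) (cs-injective : Injective _≡_ _≡_ cs) (i : Fin size) where

    x y : Fin n
    x = proj₁ (enum i)
    y = proj₂ (enum i)

    X<Y : toℕ x < toℕ y
    X<Y = proj₁ (enum-sat i)

    new-edge : HasCol G enum cs i x y (cs i)
    new-edge = inj₂ (i , ≤-refl , inj₁ refl , refl)

    -- The new edge joins the outer vertex x to the pool.  Unless its colour is that of the hub edge r x,
    -- the path r x y q serves; otherwise the new edge is followed by a path from x back into the hubs.
    module FromEarly (X<N : toℕ x < N) (N+2≤Y : suc (suc N) ≤ toℕ y) where

      r : Fin n
      r = hub (isEven (toℕ x))

      c : ℕ
      c = pairCode n (toℕ r) (toℕ x)

      X<r : toℕ x < toℕ r
      X<r = <-≤-trans X<N (N≤hub (isEven (toℕ x)))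

      N≤Y : N ≤ toℕ y
      N≤Y = N+2≤⇒N≤ N+2≤Y

      fresh-colour : cs i ≢ c → RainbowP4 N G enum cs i
      fresh-colour cs≢c = record
        { p = r ; x = x ; y = y ; q = q
        ; p≢x = toℕ->⇒≢ X<r
        ; p≢y = toℕ-<⇒≢ (<-≤-trans (hub<N+2 (isEven (toℕ x))) N+2≤Y)
        ; p≢q = toℕ-<⇒≢ (<-≤-trans (hub<N+2 (isEven (toℕ x))) N+2≤q)
        ; x≢y = toℕ-<⇒≢ X<Y
        ; x≢q = toℕ-<⇒≢ X<q
        ; y≢q = y≢q
        ; N≤p = N≤hub (isEven (toℕ x))
        ; N≤q = N+2≤⇒N≤ N+2≤q
        ; c₁ = c ; c₂ = cs i ; c₃ = pairCode n (toℕ y) (toℕ q)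
        ; px = inj₁ (edge> X<r (hub-edge (toℕ x)))
        ; xy = new-edge
        ; yq = inj₁ (clique y q N≤Y (N+2≤⇒N≤ N+2≤q) y≢q)
        ; c₁≢c₂ = ≢-sym cs≢c
        ; c₁≢c₃ = pairCode-≢′ (toℕ<n x) (toℕ<n y) (<⇒≢ X<Y) (<⇒≢ X<q)
        ; c₂≢c₃ = λ eq → ∉digits⇒pairCode≢ (toℕ<n q) (q∉ ∘ there) (trans (pairCode-comm n (toℕ q) (toℕ y)) (sym eq))
        ; through = inj₂ (inj₁ (inj₁ (refl , refl)))
        }
        where
        chosen : Σ[ q ∈ Fin n ] (suc (suc N) ≤ toℕ q × toℕ q ∉ toℕ y ∷ digits n (cs i))
        chosen = choosePool (toℕ y ∷ digits n (cs i)) (s≤s (s≤s (s≤s z≤n)))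
        q : Fin n
        q = proj₁ chosen
        N+2≤q : suc (suc N) ≤ toℕ q
        N+2≤q = proj₁ (proj₂ chosen)
        q∉ : toℕ q ∉ toℕ y ∷ digits n (cs i)
        q∉ = proj₂ (proj₂ chosen)
        X<q : toℕ x < toℕ q
        X<q = <-≤-trans X<N (N+2≤⇒N≤ N+2≤q)
        y≢q : y ≢ q
        y≢q y≡q = q∉ (here (cong toℕ (sym y≡q)))

      turn-back : cs i ≡ c → (x̄ h : Fin n) →
                  col G x x̄ ≡ just (pairCode n (toℕ x) (toℕ x̄)) → col G x̄ h ≡ just (pairCode n (toℕ x̄) (toℕ h)) →
                  N ≤ toℕ h → toℕ x̄ < suc (suc N) → toℕ h < suc (suc N) →
                  toℕ x ≢ toℕ x̄ → toℕ x ≢ toℕ h → x̄ ≢ h → toℕ r ≢ toℕ x̄ → RainbowP4 N G enum cs i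
      turn-back cs≡c x̄ h xx̄ x̄h N≤h x̄<N+2 h<N+2 X≢x̄ X≢h x̄≢h r≢x̄ = record
        { p = y ; x = x ; y = x̄ ; q = h
        ; p≢x = toℕ->⇒≢ X<Y
        ; p≢y = toℕ->⇒≢ (<-≤-trans x̄<N+2 N+2≤Y)
        ; p≢q = toℕ->⇒≢ (<-≤-trans h<N+2 N+2≤Y)
        ; x≢y = X≢x̄ ∘ cong toℕ
        ; x≢q = X≢h ∘ cong toℕ
        ; y≢q = x̄≢h
        ; N≤p = N≤Y
        ; N≤q = N≤h
        ; c₁ = cs i ; c₂ = pairCode n (toℕ x) (toℕ x̄) ; c₃ = pairCode n (toℕ x̄) (toℕ h)
        ; px = inj₂ (i , ≤-refl , inj₂ refl , refl)
        ; xy = inj₁ xx̄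
        ; yq = inj₁ x̄h
        ; c₁≢c₂ = λ eq → pairCode-≢ (toℕ<n r) (toℕ<n x) (≢-sym (<⇒≢ X<r)) r≢x̄ (trans (sym cs≡c) eq)
        ; c₁≢c₃ = λ eq → pairCode-≢′ (toℕ<n x) (toℕ<n x̄) X≢x̄ X≢h (trans (sym cs≡c) eq)
        ; c₂≢c₃ = pairCode-≢ (toℕ<n x) (toℕ<n x̄) X≢x̄ X≢h
        ; through = inj₁ (inj₂ (refl , refl))
        }

      toℕ-r : ∀ {b} → isEven (toℕ x) ≡ b → toℕ r ≡ toℕ (hub b)
      toℕ-r parity = cong (toℕ ∘ hub) parity

      matched-partner : cs i ≡ c → isEven (toℕ x) ≡ true → suc (toℕ x) < N → RainbowP4 N G enum cs i
      matched-partner cs≡c even X+1<N =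
        turn-back cs≡c x̄ β (edge< X<x̄ (matched toℕ-x̄ even (subst (λ v → suc v ≤ N) (sym toℕ-x̄) X+1<N)))
          (edge< x̄<β (oddToβ toℕ-β (trans (cong isEven toℕ-x̄) (cong not even))))
          (N≤hub false) (<-trans x̄<β (hub<N+2 false)) (hub<N+2 false)
          (<⇒≢ X<x̄) (<⇒≢ (<-trans X<x̄ x̄<β)) (toℕ-<⇒≢ x̄<β)
          (λ r≡x̄ → <⇒≢ x̄<N (trans (sym r≡x̄) (trans (toℕ-r even) toℕ-α)))
        where
        x̄ : Fin n
        x̄ = fromℕ< (<-≤-trans X+1<N (≤-trans (n≤1+n N) (≤-trans (n≤1+n (suc N)) N+2≤n)))
        toℕ-x̄ : toℕ x̄ ≡ suc (toℕ x)
        toℕ-x̄ = toℕ-fromℕ< _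
        x̄<N : toℕ x̄ < N
        x̄<N = subst (_< N) (sym toℕ-x̄) X+1<N
        X<x̄ : toℕ x < toℕ x̄
        X<x̄ = subst (toℕ x <_) (sym toℕ-x̄) ≤-refl
        x̄<β : toℕ x̄ < toℕ β
        x̄<β = subst (toℕ x̄ <_) (sym toℕ-β) (<-trans x̄<N (n<1+n N))

      α<β : toℕ α < toℕ β
      α<β = subst₂ _<_ (sym toℕ-α) (sym toℕ-β) (n<1+n N)

      last-to-β : cs i ≡ c → isEven (toℕ x) ≡ true → suc (toℕ x) ≡ N → RainbowP4 N G enum cs i
      last-to-β cs≡c even last =
        turn-back cs≡c β α (edge< X<β (lastToβ toℕ-β last))
          (clique β α (N≤hub false) (N≤hub true) (toℕ->⇒≢ α<β))
          (N≤hub true) (hub<N+2 false) (hub<N+2 true)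
          (<⇒≢ X<β) (<⇒≢ (subst (toℕ x <_) (sym toℕ-α) X<N)) (toℕ->⇒≢ α<β)
          (λ r≡β → <⇒≢ α<β (trans (sym (toℕ-r even)) r≡β))
        where
        X<β : toℕ x < toℕ β
        X<β = subst (toℕ x <_) (sym toℕ-β) (<-trans X<N (n<1+n N))

      odd-partner : cs i ≡ c → isEven (toℕ x) ≡ false → RainbowP4 N G enum cs i
      odd-partner cs≡c odd =
        turn-back cs≡c x̄ α (edge> x̄<x (matched (trans X≡ (cong suc (sym toℕ-x̄))) even-x̄ X<N))
          (edge< x̄<α (evenToα toℕ-α even-x̄))
          (N≤hub true) (<-trans x̄<α (hub<N+2 true)) (hub<N+2 true)
          (≢-sym (<⇒≢ x̄<x)) (<⇒≢ (subst (toℕ x <_) (sym toℕ-α) X<N)) (toℕ-<⇒≢ x̄<α)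
          (λ r≡x̄ → <⇒≢ (<-trans x̄<α α<β) (trans (sym r≡x̄) (toℕ-r odd)))
        where
        X' : ℕ
        X' = proj₁ (odd⇒suc-even (toℕ x) odd)
        X≡ : toℕ x ≡ suc X'
        X≡ = proj₁ (proj₂ (odd⇒suc-even (toℕ x) odd))
        x̄ : Fin n
        x̄ = fromℕ< {X'} (<-trans (subst (X' <_) (sym X≡) ≤-refl) (toℕ<n x))
        toℕ-x̄ : toℕ x̄ ≡ X'
        toℕ-x̄ = toℕ-fromℕ< _
        even-x̄ : isEven (toℕ x̄) ≡ true
        even-x̄ = trans (cong isEven toℕ-x̄) (proj₂ (proj₂ (odd⇒suc-even (toℕ x) odd)))
        x̄<x : toℕ x̄ < toℕ x
        x̄<x = subst₂ _<_ (sym toℕ-x̄) (sym X≡) ≤-refl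
        x̄<α : toℕ x̄ < toℕ α
        x̄<α = subst (toℕ x̄ <_) (sym toℕ-α) (<-trans x̄<x X<N)

      rainbowP4 : RainbowP4 N G enum cs i
      rainbowP4 = [ reused-colour , fresh-colour ]′ (toSum (cs i ≟ c))
        where
        reused-colour : cs i ≡ c → RainbowP4 N G enum cs i
        reused-colour cs≡c = [ even-case , odd-partner cs≡c ∘ ¬-not ]′ (toSum (isEven (toℕ x) ≟ᵇ true))
          where
          even-case : isEven (toℕ x) ≡ true → RainbowP4 N G enum cs i
          even-case even = [ matched-partner cs≡c even , last-to-β cs≡c even ∘ ≤-antisym X<N ∘ ≮⇒≥ ]′
                             (toSum (suc (toℕ x) <? N))

    -- All outer–pool edges are already present, so x reaches the pool vertex P by an earlier edge.
    module FromLate (late : ¬ Early (enum i)) where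

      X<N : toℕ x < N
      X<N = [ id , (λ X≮N → ⊥-elim (nonEdge⇒¬HostEdge X<Y (proj₂ (enum-sat i)) (inClique (≮⇒≥ X≮N)))) ]′
              (toSum (toℕ x <? N))

      Y<N+2 : toℕ y < suc (suc N)
      Y<N+2 = [ id , (λ Y≮N+2 → ⊥-elim (late (X<N , ≮⇒≥ Y≮N+2))) ]′ (toSum (toℕ y <? suc (suc N)))

      P : Fin n
      P = pool {0} z≤n

      N+2≤P : suc (suc N) ≤ toℕ P
      N+2≤P = N+2≤pool z≤n

      earlier-P : ∃[ j ] (enum j ≡ (x , P) × toℕ j ≤ toℕ i)
      earlier-P = earlier i (X<N , N+2≤P) late

      jP : Fin size
      jP = proj₁ earlier-P

      enum-jP : enum jP ≡ (x , P)
      enum-jP = proj₁ (proj₂ earlier-P)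

      jP≤i : toℕ jP ≤ toℕ i
      jP≤i = proj₂ (proj₂ earlier-P)

      csP≢csi : cs jP ≢ cs i
      csP≢csi eq = <⇒≱ Y<N+2 (subst (λ w → suc (suc N) ≤ toℕ w) P≡y N+2≤P)
        where
        P≡y : P ≡ y
        P≡y = cong proj₂ (trans (sym enum-jP) (cong enum (cs-injective eq)))

      via : (q : Fin n) → suc (suc N) ≤ toℕ q → P ≢ q → (c₃ : ℕ) → HasCol G enum cs i y q c₃ →
            cs jP ≢ c₃ → cs i ≢ c₃ → RainbowP4 N G enum cs i
      via q N+2≤q P≢q c₃ yq c₁≢c₃ c₂≢c₃ = record
        { p = P ; x = x ; y = y ; q = q
        ; p≢x = toℕ->⇒≢ (<-≤-trans X<N (N+2≤⇒N≤ N+2≤P))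
        ; p≢y = toℕ->⇒≢ (<-≤-trans Y<N+2 N+2≤P)
        ; p≢q = P≢q
        ; x≢y = toℕ-<⇒≢ X<Y
        ; x≢q = toℕ-<⇒≢ (<-≤-trans X<N (N+2≤⇒N≤ N+2≤q))
        ; y≢q = toℕ-<⇒≢ (<-≤-trans Y<N+2 N+2≤q)
        ; N≤p = N+2≤⇒N≤ N+2≤P
        ; N≤q = N+2≤⇒N≤ N+2≤q
        ; c₁ = cs jP ; c₂ = cs i ; c₃ = c₃
        ; px = inj₂ (jP , jP≤i , inj₂ enum-jP , refl)
        ; xy = new-edge
        ; yq = yq
        ; c₁≢c₂ = csP≢csi
        ; c₁≢c₃ = c₁≢c₃
        ; c₂≢c₃ = c₂≢c₃
        ; through = inj₂ (inj₁ (inj₁ (refl , refl)))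
        }

      outer-end : toℕ y < N → RainbowP4 N G enum cs i
      outer-end Y<N =
        via Q (N+2≤pool (s≤s z≤n)) P≢Q (cs jQ) (inj₂ (jQ , jQ≤i , inj₁ enum-jQ , refl))
          (λ eq → toℕ-<⇒≢ X<Y (cong proj₁ (trans (sym enum-jP) (trans (cong enum (cs-injective eq)) enum-jQ))))
          (λ eq → toℕ-<⇒≢ X<Y (cong proj₁ (trans (cong enum (cs-injective eq)) enum-jQ)))
        where
        Q : Fin n
        Q = pool {1} (s≤s z≤n)
        earlier-Q : ∃[ j ] (enum j ≡ (y , Q) × toℕ j ≤ toℕ i)
        earlier-Q = earlier i (Y<N , N+2≤pool (s≤s z≤n)) late
        jQ : Fin size
        jQ = proj₁ earlier-Q
        enum-jQ : enum jQ ≡ (y , Q)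
        enum-jQ = proj₁ (proj₂ earlier-Q)
        jQ≤i : toℕ jQ ≤ toℕ i
        jQ≤i = proj₂ (proj₂ earlier-Q)
        P≢Q : P ≢ Q
        P≢Q P≡Q = 1+n≢n (sym (+-cancelˡ-≡ (suc (suc N)) 0 1
                    (trans (sym (toℕ-pool z≤n)) (trans (cong toℕ P≡Q) (toℕ-pool (s≤s z≤n))))))

      hub-end-avoid : List ℕ
      hub-end-avoid = toℕ P ∷ digits n (cs jP) ++ digits n (cs i)

      hub-end : N ≤ toℕ y → RainbowP4 N G enum cs i
      hub-end N≤Y =
        via q N+2≤q P≢q (pairCode n (toℕ y) (toℕ q))
          (inj₁ (clique y q N≤Y (N+2≤⇒N≤ N+2≤q) (toℕ-<⇒≢ (<-≤-trans Y<N+2 N+2≤q))))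
          (avoids (there ∘ ∈-++⁺ˡ)) (avoids (there ∘ ∈-++⁺ʳ (digits n (cs jP))))
        where
        chosen : Σ[ q ∈ Fin n ] (suc (suc N) ≤ toℕ q × toℕ q ∉ hub-end-avoid)
        chosen = choosePool hub-end-avoid ≤-refl
        q : Fin n
        q = proj₁ chosen
        N+2≤q : suc (suc N) ≤ toℕ q
        N+2≤q = proj₁ (proj₂ chosen)
        q∉ : toℕ q ∉ hub-end-avoid
        q∉ = proj₂ (proj₂ chosen)
        P≢q : P ≢ q
        P≢q P≡q = q∉ (here (cong toℕ (sym P≡q)))
        avoids : ∀ {c} → digits n c ⊆ hub-end-avoid → c ≢ pairCode n (toℕ y) (toℕ q)
        avoids ⊆avoid eq = ∉digits⇒pairCode≢ (toℕ<n q) (q∉ ∘ ⊆avoid) (trans (pairCode-comm n (toℕ q) (toℕ y)) (sym eq))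

      rainbowP4 : RainbowP4 N G enum cs i
      rainbowP4 = [ outer-end , hub-end ∘ ≮⇒≥ ]′ (toSum (toℕ y <? N))

    rainbowP4 : RainbowP4 N G enum cs i
    rainbowP4 = [ uncurry FromEarly.rainbowP4 , FromLate.rainbowP4 ]′ (toSum (Early? (enum i)))

  saturated : WeaklyRainbowSat H G
  saturated = size , enum , enum-sat , enum-injective , enum-onto ,
              λ cs cs-injective i → Embedding.copy P4 room clique (Step.rainbowP4 cs cs-injective i)

completeCol : ∀ {n} → Fin n → Fin n → Maybe ℕ
completeCol z z' with z Fin.≟ z'
... | yes _ = nothing
... | no _  = just 0

complete : ∀ n → ColGraph n
complete n = record { col = completeCol ; csym = comm ; cirr = irr }
  where
  comm : ∀ z z' → completeCol z z' ≡ completeCol z' z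
  comm z z' with z Fin.≟ z' | z' Fin.≟ z
  ... | yes _    | yes _    = refl
  ... | no _     | no _     = refl
  ... | yes z≡z' | no z'≢z  = ⊥-elim (z'≢z (sym z≡z'))
  ... | no z≢z'  | yes z'≡z = ⊥-elim (z≢z' (sym z'≡z))
  irr : ∀ z → completeCol z z ≡ nothing
  irr z with z Fin.≟ z
  ... | yes _ = refl
  ... | no z≢z = ⊥-elim (z≢z refl)

completeCol≡nothing⇒≡ : ∀ {n} {z z' : Fin n} → completeCol z z' ≡ nothing → z ≡ z'
completeCol≡nothing⇒≡ {z = z} {z'} none with z Fin.≟ z'
... | yes z≡z' = z≡z'

complete-saturated : ∀ {k} (H : Graph k) n → WeaklyRainbowSat H (complete n)
complete-saturated H n = 0 , (λ ()) , (λ ()) , (λ {}) ,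
  (λ z z' z<z' none → ⊥-elim (<-irrefl (cong toℕ (completeCol≡nothing⇒≡ none)) z<z')) , (λ _ _ ())

proposition4p3 : ∀ {k} (H : Graph k) → InF H → δ'≡2 H →
    ∃[ c ] (∀ (n : ℕ) → Σ[ G ∈ ColGraph n ] (WeaklyRainbowSat H G × 2 * eCount G ≤ 3 * n + c))
proposition4p3 {k} H inF _ = 1 + 2 * (s * s) , witness
  where
  s : ℕ
  s = 8 + 11 * k
  small : ∀ {n} (G : ColGraph n) → n ≤ s → 2 * eCount G ≤ 3 * n + (1 + 2 * (s * s))
  small {n} G n≤s = begin
    2 * eCount G              ≤⟨ *-monoʳ-≤ 2 (≤-trans (eCount≤n*n G) (*-mono-≤ n≤s n≤s)) ⟩
    2 * (s * s)               ≤⟨ m≤n+m _ (3 * n + 1) ⟩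
    3 * n + 1 + 2 * (s * s)   ≡⟨ +-assoc (3 * n) 1 _ ⟩
    3 * n + (1 + 2 * (s * s)) ∎
    where open ≤-Reasoning
  witness : ∀ n → Σ[ G ∈ ColGraph n ] (WeaklyRainbowSat H G × 2 * eCount G ≤ 3 * n + (1 + 2 * (s * s)))
  witness n with n <? s
  ... | yes n<s = complete n , complete-saturated H n , small (complete n) (<⇒≤ n<s)
  ... | no n≮s  = subst (λ n → Σ[ G ∈ ColGraph n ] (WeaklyRainbowSat H G × 2 * eCount G ≤ 3 * n + (1 + 2 * (s * s))))
                        (m∸n+n≡m (≮⇒≥ n≮s))
                        ( Host.G (n ∸ s) s
                        , Saturation.saturated (InF⇒BareMiddleP4 {H = H} inF) (n ∸ s)
                        , Host.2*eCount≤ (n ∸ s) s )
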